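{- Let $t\ge 1$ and let $N$ be the $t$-th power of an integer. Assume that for some $C$ and $D$, for every integer $c$ with $1\le c<t$, there exists a bipartite graph with $C N^{(c+1)/t}$ left nodes, at most $C N^{c/t}$ right nodes, left degree at most $D$, which has dynamic matching up to $N^{c/t}$ (with load $1$). Then there exists an $N$-connector of depth $t$ with at most $tCD\,N^{1+1/t}$ edges.
   Context: Dynamic matching game with parameter $K$ and load $1$ on a bipartite graph: Requester and Matcher alternate turns (Requester starts), maintaining a set $M$ of edges, initially empty. Requester removes zero or more edges from $M$ so that afterwards $\#M\le K-1$, and selects a left node $x$. Matcher then adds an edge to $M$; afterwards $x$ must be incident on an edge of $M$ and each right node must be incident on at most one edge of $M$, otherwise Matcher loses. The graph has dynamic matching up to $K$ if Matcher has a strategy with which she never loses. An $N$-network is a directed acyclic graph in which $N$ nodes are designated inputs and $N$ nodes are designated outputs; its depth is the length of the longest path from an input to an output. Connection game: Requester and Connector alternate turns (Requester starts) and maintain a set of node-disjoint trees, each with an input as root and outputs as leaves, initially empty. Requester may remove zero or more trees and then may select an input $x$ and an output $y$ not lying on any tree. Connector may create or extend a tree; afterwards there must be a tree with root $x$ having $y$ as a leaf (trees remaining node-disjoint). An $N$-connector is an $N$-network in which Connector has a strategy that always satisfies these conditions. -}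

module Defs where

open import Level using (0ℓ)
open import Data.Nat using (ℕ; zero; suc; _+_; _≤_; _<_; _^_)
open import Data.Fin using (Fin; _≟_)
open import Data.Fin.Subset using (Subset; _∈_; _∉_; _⊆_; _∪_; ⁅_⁆; ∣_∣; Nonempty)
open import Data.Fin.Subset.Properties using (_∈?_)
open import Data.List using (List; []; _∷_; length; filter; map; allFin)
open import Data.Nat.ListAction using (sum)
open import Data.List.Relation.Binary.Sublist.Propositional using () renaming (_⊆_ to _⊑_)
open import Data.List.Relation.Unary.All using (All)
open import Data.List.Relation.Unary.Any using (Any)
open import Data.List.Relation.Unary.AllPairs using (AllPairs)
open import Data.Product using (Σ; ∃; ∃-syntax; _×_; _,_)
open import Data.Sum using (_⊎_)
open import Data.Bool using (if_then_else_)
open import Data.Empty using (⊥)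
open import Data.Integer using (+_)
open import Data.Rational using (ℚ; _/_)
open import Function using (Injective)
open import Relation.Nullary using (¬_; ⌊_⌋)
open import Relation.Binary.PropositionalEquality using (_≡_)

ℕtoℚ : ℕ → ℚ
ℕtoℚ m = + m / 1

-- A bipartite graph with left nodes Fin L and right nodes Fin R:
-- G x is the set of right neighbours of the left node x.
BipGraph : ℕ → ℕ → Set
BipGraph L R = Fin L → Subset R

leftDegree : ∀ {L R} → BipGraph L R → Fin L → ℕ
leftDegree G x = ∣ G x ∣

-- A set M of edges: M x is the set of right nodes y with (x , y) ∈ M.
EdgeSet : ℕ → ℕ → Set
EdgeSet L R = Fin L → Subset R

emptyEdges : ∀ {L R} → EdgeSet L R
emptyEdges _ = Data.Fin.Subset.⊥
  where import Data.Fin.Subset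

#edges : ∀ {L R} → EdgeSet L R → ℕ
#edges {L} M = sum (map (λ x → ∣ M x ∣) (allFin L))

_⊆ₑ_ : ∀ {L R} → EdgeSet L R → EdgeSet L R → Set
M' ⊆ₑ M = ∀ x → M' x ⊆ M x

addEdge : ∀ {L R} → EdgeSet L R → Fin L → Fin R → EdgeSet L R
addEdge M x' y x = if ⌊ x ≟ x' ⌋ then M x ∪ ⁅ y ⁆ else M x

rightLoad : ∀ {L R} → EdgeSet L R → Fin R → ℕ
rightLoad {L} M y = length (filter (λ x → y ∈? M x) (allFin L))

-- One round, seen from Matcher: for every Requester move from position M
-- (remove edges to get M' ⊆ M with #M' ≤ K-1, select left node x) Matcher
-- has an answer (an edge of G) after which she has not lost and the new
-- position lies in the set S.
-- G has dynamic matching up to K (load 1) iff Matcher has a strategy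
-- that never loses, i.e. iff the empty initial position lies in a set of
-- positions S that Matcher can maintain forever (a post-fixed point of the
-- one-round operator; the game only depends on the current set M).
DynMatching : ∀ {L R} → BipGraph L R → ℕ → Set₁
DynMatching {L} {R} G K =
  Σ (EdgeSet L R → Set) λ S →
    S emptyEdges ×
    (∀ M → S M →
      ∀ (M' : EdgeSet L R) → M' ⊆ₑ M → suc (#edges M') ≤ K →
      ∀ (x : Fin L) →
      ∃[ x' ] ∃[ y ] (y ∈ G x' ×
        Nonempty (addEdge M' x' y x) ×
        (∀ z → rightLoad (addEdge M' x' y) z ≤ 1) ×
        S (addEdge M' x' y)))

data Path {V : ℕ} (E : Fin V → Subset V) : Fin V → Fin V → ℕ → Set where
  here  : ∀ {u} → Path E u u zero
  step  : ∀ {u v w k} → v ∈ E u → Path E v w k → Path E u w (suc k)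

Acyclic : ∀ {V} → (Fin V → Subset V) → Set
Acyclic E = ∀ v k → ¬ Path E v v (suc k)

record Network (N : ℕ) : Set where
  field
    V        : ℕ
    E        : Fin V → Subset V
    acyclic  : Acyclic E
    inp      : Fin N → Fin V
    out      : Fin N → Fin V
    inp-inj  : Injective _≡_ _≡_ inp
    out-inj  : Injective _≡_ _≡_ out
    disjoint : ∀ i j → ¬ (inp i ≡ out j)

edgeCount : ∀ {N} → Network N → ℕ
edgeCount net = sum (map (λ u → ∣ E u ∣) (allFin V))
  where open Network net

-- depth = length of a longest input→output path.  "Depth t": all such
-- paths have length ≤ t, and (when there is at least one input) one has
-- length exactly t.
HasDepth : ∀ {N} → Network N → ℕ → Set
HasDepth {N} net t =
  (∀ i j k → Path E (inp i) (out j) k → k ≤ t) ×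
  (1 ≤ N → ∃[ i ] ∃[ j ] Path E (inp i) (out j) t)
  where open Network net

module _ {N : ℕ} (net : Network N) where
  open Network net

  -- A (candidate) tree: an input index as root and a set of tree edges
  -- (tedges u = tree-successors of u).
  record TreeData : Set where
    constructor tree
    field
      root   : Fin N
      tedges : Fin V → Subset V
  open TreeData public

  OnTree : TreeData → Fin V → Set
  OnTree T v = v ≡ inp (root T) ⊎ ∃[ u ] v ∈ tedges T u

  IsLeaf : TreeData → Fin V → Set
  IsLeaf T v = OnTree T v × (∀ w → w ∉ tedges T v)

  IsOutput : Fin V → Set
  IsOutput v = ∃[ j ] v ≡ out j

  -- T is a tree of the network rooted at its input, all of whose leaves
  -- are outputs: tree edges are network edges, tails of tree edges lie on
  -- the tree, the root has no incoming tree edge, every other node has at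
  -- most one incoming tree edge (so, the network being acyclic, the tree
  -- edges form an arborescence rooted at the root).
  ValidTree : TreeData → Set
  ValidTree T =
    (∀ u → tedges T u ⊆ E u) ×
    (∀ u v → v ∈ tedges T u → OnTree T u) ×
    (∀ u → inp (root T) ∉ tedges T u) ×
    (∀ u u' v → v ∈ tedges T u → v ∈ tedges T u' → u ≡ u') ×
    (∀ v → IsLeaf T v → IsOutput v)

  NodeDisjoint : TreeData → TreeData → Set
  NodeDisjoint T T' = ∀ v → ¬ (OnTree T v × OnTree T' v)

  ValidState : List TreeData → Set
  ValidState ts = All ValidTree ts × AllPairs NodeDisjoint ts

  NotOnTrees : List TreeData → Fin V → Set
  NotOnTrees ts v = All (λ T → ¬ OnTree T v) ts

  Extends : TreeData → TreeData → Set
  Extends T T' = root T' ≡ root T × (∀ u → tedges T u ⊆ tedges T' u)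

  data ConnectorMove : List TreeData → List TreeData → Set where
    keep   : ∀ {ts} → ConnectorMove ts ts
    create : ∀ {ts} T → ConnectorMove ts (T ∷ ts)
    extend : ∀ {T T' ts} → Extends T T' → ConnectorMove (T ∷ ts) (T' ∷ ts)
    later  : ∀ {T ts ts'} → ConnectorMove ts ts' →
             ConnectorMove (T ∷ ts) (T ∷ ts')

  Request : List TreeData → Set
  Request ts = ∃[ x ] ∃[ y ] (NotOnTrees ts (inp x) × NotOnTrees ts (out y))

  Satisfies : List TreeData → Fin N → Fin N → Set
  Satisfies ts x y = Any (λ T → root T ≡ x × IsLeaf T (out y)) ts

  -- the network is an N-connector: Connector has a strategy that always
  -- satisfies the conditions (post-fixed point formulation, the game only
  -- depending on the current set of trees).
  IsConnector : Set₁
  IsConnector =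
    Σ (List TreeData → Set) λ S →
      S [] ×
      (∀ ts → S ts → ∀ ts₁ → ts₁ ⊑ ts →
        (∃[ ts₂ ] (ConnectorMove ts₁ ts₂ × ValidState ts₂ × S ts₂)) ×
        (∀ x y → NotOnTrees ts₁ (inp x) → NotOnTrees ts₁ (out y) →
          ∃[ ts₂ ] (ConnectorMove ts₁ ts₂ × ValidState ts₂ ×
                    Satisfies ts₂ x y × S ts₂)))

{-# OPTIONS --safe #-}

-- The connector of depth k+1 puts the left nodes of graph k above n copies of the connector of
-- depth k and joins a left node, in every copy, to the top nodes that are its neighbours in graph
-- k; the right nodes of graph k are the first left nodes of graph k-1, and the outputs are
-- addressed by their n-ary digits. A request (x, y) is routed downwards: in the copy selected by
-- the leading digit of y, the game on graph k is played separately, and Matcher's answer to the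
-- current left node gives the next node. Since a copy of depth k has only n^k outputs, it carries
-- fewer than n^k routes, so Requester's moves stay within the range where Matcher wins, and load 1
-- keeps the routes node-disjoint. The depth-(k+1) network has at most n·|E(G_k)| ≤ n·C·D·n^(k+1)
-- edges besides those of its n copies, which adds up to t·C·D·n^(t+1) at depth t.
module Submission where

open import Data.Nat using (ℕ; suc; _≤_; _<_; _^_)

module Counting where

  open import Data.Nat using (ℕ; zero; suc; _+_; _*_; _≤_; z≤n; s≤s)
  open import Data.Nat.Properties hiding (_≟_)
  open import Algebra.Properties.CommutativeSemigroup +-commutativeSemigroup using () renaming (interchange to +-interchange)
  open import Data.Bool using (true; false; if_then_else_)
  open import Data.Fin using (Fin; zero; suc; _↑ˡ_; _↑ʳ_; combine)
  open import Data.Fin.Properties using (_≟_; any?)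
  open import Data.Fin.Subset using (Subset; _∈_; _∪_; ∣_∣)
  open import Data.Fin.Subset.Properties using (∣p∣≤∣x∷p∣; _∈?_)
  open import Data.List as List using (map; allFin)
  open import Data.List.Properties using (map-tabulate)
  open import Data.Nat.ListAction using (sum)
  open import Data.Vec using ([]; _∷_; tabulate)
  open import Data.Vec.Properties using ([]=⇒lookup; lookup⇒[]=; lookup∘tabulate)
  open import Data.Empty using (⊥-elim)
  open import Function using (_∘_)
  open import Relation.Nullary using (Dec; yes; no; does; ¬_)
  open import Relation.Nullary.Decidable using (dec-true)
  open import Relation.Binary.PropositionalEquality

  ⟦_⟧ : ∀ {p} {P : Set p} → Dec P → ℕ
  ⟦ P? ⟧ = if does P? then 1 else 0

  ⟦⟧-no : ∀ {p} {P : Set p} (P? : Dec P) → ¬ P → ⟦ P? ⟧ ≡ 0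
  ⟦⟧-no (yes p) ¬p = ⊥-elim (¬p p)
  ⟦⟧-no (no _) _ = refl

  ⟦⟧-mono : ∀ {p q} {P : Set p} {Q : Set q} (P? : Dec P) (Q? : Dec Q) → (P → Q) → ⟦ P? ⟧ ≤ ⟦ Q? ⟧
  ⟦⟧-mono (yes p) (yes _) _ = ≤-refl
  ⟦⟧-mono (yes p) (no ¬q) P⇒Q = ⊥-elim (¬q (P⇒Q p))
  ⟦⟧-mono (no _) _ _ = z≤n

  ⟦⟧-cong : ∀ {p q} {P : Set p} {Q : Set q} (P? : Dec P) (Q? : Dec Q) → (P → Q) → (Q → P) → ⟦ P? ⟧ ≡ ⟦ Q? ⟧
  ⟦⟧-cong P? Q? P⇒Q Q⇒P = ≤-antisym (⟦⟧-mono P? Q? P⇒Q) (⟦⟧-mono Q? P? Q⇒P)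

  ⟦any?⟧≤ : ∀ {r p} {P : Fin (suc r) → Set p} (P? : ∀ j → Dec (P j)) →
            ⟦ any? P? ⟧ ≤ ⟦ P? zero ⟧ + ⟦ any? (P? ∘ suc) ⟧
  ⟦any?⟧≤ P? with P? zero
  ... | yes _ = s≤s z≤n
  ... | no _ = ≤-refl

  ∑ : ∀ {m} → (Fin m → ℕ) → ℕ
  ∑ {zero} f = 0
  ∑ {suc m} f = f zero + ∑ (f ∘ suc)

  ∑-mono : ∀ {m} {f g : Fin m → ℕ} → (∀ i → f i ≤ g i) → ∑ f ≤ ∑ g
  ∑-mono {zero} f≤g = z≤n
  ∑-mono {suc m} f≤g = +-mono-≤ (f≤g zero) (∑-mono (f≤g ∘ suc))

  ∑-cong : ∀ {m} {f g : Fin m → ℕ} → (∀ i → f i ≡ g i) → ∑ f ≡ ∑ g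
  ∑-cong {zero} f≗g = refl
  ∑-cong {suc m} f≗g = cong₂ _+_ (f≗g zero) (∑-cong (f≗g ∘ suc))

  ∑-distrib-+ : ∀ {m} (f g : Fin m → ℕ) → ∑ (λ i → f i + g i) ≡ ∑ f + ∑ g
  ∑-distrib-+ {zero} f g = refl
  ∑-distrib-+ {suc m} f g =
    trans (cong (f zero + g zero +_) (∑-distrib-+ (f ∘ suc) (g ∘ suc))) (+-interchange (f zero) (g zero) _ _)

  ∑-const : ∀ {m} c → ∑ {m} (λ _ → c) ≡ m * c
  ∑-const {zero} c = refl
  ∑-const {suc m} c = cong (c +_) (∑-const {m} c)

  ∑-zero : ∀ {m} {f : Fin m → ℕ} → (∀ i → f i ≡ 0) → ∑ f ≡ 0
  ∑-zero {zero} _ = refl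
  ∑-zero {suc m} f≡0 = cong₂ _+_ (f≡0 zero) (∑-zero (f≡0 ∘ suc))

  ∑-*ʳ : ∀ {m} (f : Fin m → ℕ) c → ∑ (λ i → f i * c) ≡ ∑ f * c
  ∑-*ʳ {zero} f c = refl
  ∑-*ʳ {suc m} f c = trans (cong (f zero * c +_) (∑-*ʳ (f ∘ suc) c)) (sym (*-distribʳ-+ c (f zero) (∑ (f ∘ suc))))

  ∑-term≤ : ∀ {m} (f : Fin m → ℕ) i → f i ≤ ∑ f
  ∑-term≤ f zero = m≤m+n (f zero) _
  ∑-term≤ f (suc i) = ≤-trans (∑-term≤ (f ∘ suc) i) (m≤n+m _ (f zero))

  ∑-indicator : ∀ {m} (a : Fin m) → ∑ (λ i → ⟦ i ≟ a ⟧) ≡ 1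
  ∑-indicator {suc m} zero = cong suc (∑-zero {m} (λ _ → refl))
  ∑-indicator {suc m} (suc a) = ∑-indicator a

  ∑-indicator-* : ∀ {m} (a : Fin m) c → ∑ (λ i → ⟦ i ≟ a ⟧ * c) ≡ c
  ∑-indicator-* {m} a c = trans (∑-*ʳ (λ i → ⟦ i ≟ a ⟧) c) (trans (cong (_* c) (∑-indicator a)) (*-identityˡ c))

  ∑-↑ : ∀ a {b} (f : Fin (a + b) → ℕ) → ∑ f ≡ ∑ (λ i → f (i ↑ˡ b)) + ∑ (λ j → f (a ↑ʳ j))
  ∑-↑ zero f = refl
  ∑-↑ (suc a) f = trans (cong (f zero +_) (∑-↑ a (f ∘ suc))) (sym (+-assoc (f zero) _ _))

  ∑-combine : ∀ a {b} (f : Fin (a * b) → ℕ) → ∑ f ≡ ∑ {a} (λ i → ∑ {b} (λ j → f (combine i j)))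
  ∑-combine zero f = refl
  ∑-combine (suc a) {b} f = trans (∑-↑ b f) (cong (∑ {b} (λ j → f (j ↑ˡ (a * b))) +_) (∑-combine a (f ∘ (b ↑ʳ_))))

  sum-map-allFin : ∀ m (f : Fin m → ℕ) → sum (map f (allFin m)) ≡ ∑ f
  sum-map-allFin m f = trans (cong sum (map-tabulate (λ i → i) f)) (sum-tabulate m f)
    where
    sum-tabulate : ∀ m (f : Fin m → ℕ) → sum (List.tabulate f) ≡ ∑ f
    sum-tabulate zero f = refl
    sum-tabulate (suc m) f = cong (f zero +_) (sum-tabulate m (f ∘ suc))

  subset : ∀ {m p} {P : Fin m → Set p} → (∀ i → Dec (P i)) → Subset m
  subset P? = tabulate (λ i → does (P? i))

  module _ {m p} {P : Fin m → Set p} (P? : ∀ i → Dec (P i)) where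

    ∈-subset⁺ : ∀ {i} → P i → i ∈ subset P?
    ∈-subset⁺ {i} Pi = lookup⇒[]= i (subset P?) (trans (lookup∘tabulate _ i) (dec-true (P? i) Pi))

    ∈-subset⁻ : ∀ {i} → i ∈ subset P? → P i
    ∈-subset⁻ {i} i∈ with P? i | trans (sym (lookup∘tabulate (λ i → does (P? i)) i)) ([]=⇒lookup i∈)
    ... | yes Pi | _ = Pi

  ∣subset∣≡∑ : ∀ {m p} {P : Fin m → Set p} (P? : ∀ i → Dec (P i)) → ∣ subset P? ∣ ≡ ∑ (λ i → ⟦ P? i ⟧)
  ∣subset∣≡∑ {zero} P? = refl
  ∣subset∣≡∑ {suc m} P? with P? zero
  ... | yes _ = cong suc (∣subset∣≡∑ (P? ∘ suc))
  ... | no _ = ∣subset∣≡∑ (P? ∘ suc)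

  ∣p∣≡∑∈ : ∀ {m} (p : Subset m) → ∣ p ∣ ≡ ∑ (λ j → ⟦ j ∈? p ⟧)
  ∣p∣≡∑∈ [] = refl
  ∣p∣≡∑∈ (true ∷ p) = cong suc (∣p∣≡∑∈ p)
  ∣p∣≡∑∈ (false ∷ p) = ∣p∣≡∑∈ p

  ∣p∪q∣≤∣p∣+∣q∣ : ∀ {m} (p q : Subset m) → ∣ p ∪ q ∣ ≤ ∣ p ∣ + ∣ q ∣
  ∣p∪q∣≤∣p∣+∣q∣ [] [] = z≤n
  ∣p∪q∣≤∣p∣+∣q∣ (true ∷ p) (b ∷ q) = s≤s (≤-trans (∣p∪q∣≤∣p∣+∣q∣ p q) (+-monoʳ-≤ ∣ p ∣ (∣p∣≤∣x∷p∣ b q)))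
  ∣p∪q∣≤∣p∣+∣q∣ (false ∷ p) (true ∷ q) = ≤-trans (s≤s (∣p∪q∣≤∣p∣+∣q∣ p q)) (≤-reflexive (sym (+-suc _ _)))
  ∣p∪q∣≤∣p∣+∣q∣ (false ∷ p) (false ∷ q) = ∣p∪q∣≤∣p∣+∣q∣ p q

module Lists where

  open import Data.Nat using (_≤_; s≤s)
  open import Data.Nat.Properties using (m≤n⇒m≤1+n)
  open import Data.Fin using (Fin; zero; suc)
  open import Data.Fin.Properties using (injective⇒≤)
  open import Data.List as List using (List; []; _∷_; length; filter)
  open import Data.List.Properties using (filter-accept; filter-reject)
  open import Data.List.Membership.Propositional using (_∈_)
  open import Data.List.Membership.Propositional.Properties using (∈-lookup; ∈-length)
  open import Data.List.Relation.Unary.All as All using (All; []; _∷_)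
  open import Data.List.Relation.Unary.Any using (here; there)
  open import Data.List.Relation.Unary.AllPairs as AllPairs using (AllPairs; []; _∷_)
  open import Data.List.Relation.Binary.Sublist.Propositional using ([]; _∷_; _∷ʳ_) renaming (_⊆_ to _⊑_)
  open import Data.List.Relation.Binary.Sublist.Propositional.Properties using (All-resp-⊆)
  open import Data.Empty using (⊥-elim)
  open import Function using (Injective)
  open import Relation.Nullary using (Dec; yes; no; ¬_)
  open import Relation.Binary.Definitions using (DecidableEquality)
  open import Relation.Binary.PropositionalEquality

  module _ {A : Set} where

    AllPairs-resp-⊑ : ∀ {R : A → A → Set} {xs ys} → xs ⊑ ys → AllPairs R ys → AllPairs R xs
    AllPairs-resp-⊑ [] [] = []
    AllPairs-resp-⊑ (_ ∷ʳ xs⊑ys) (_ ∷ Rys) = AllPairs-resp-⊑ xs⊑ys Rys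
    AllPairs-resp-⊑ (refl ∷ xs⊑ys) (Ry ∷ Rys) = All-resp-⊆ xs⊑ys Ry ∷ AllPairs-resp-⊑ xs⊑ys Rys

    All-filter⁻ : ∀ {P Q : A → Set} (Q? : ∀ x → Dec (Q x)) {xs} → All P (filter Q? xs) → All (λ x → Q x → P x) xs
    All-filter⁻ Q? {[]} [] = []
    All-filter⁻ Q? {x ∷ xs} Pxs with Q? x
    All-filter⁻ Q? {x ∷ xs} (Px ∷ Pxs) | yes _ = (λ _ → Px) ∷ All-filter⁻ Q? Pxs
    All-filter⁻ Q? {x ∷ xs} Pxs | no ¬Qx = (λ Qx → ⊥-elim (¬Qx Qx)) ∷ All-filter⁻ Q? Pxs

    AllPairs-filter-key : ∀ {K : Set} {R : A → A → Set} (key : A → K) (_≟_ : DecidableEquality K) {xs} →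
                          (∀ c → AllPairs R (filter (λ a → key a ≟ c) xs)) →
                          AllPairs (λ a b → key a ≡ key b → R a b) xs
    AllPairs-filter-key key _≟_ {[]} _ = []
    AllPairs-filter-key {R = R} key _≟_ {x ∷ xs} classes = same-key-as-x ∷ AllPairs-filter-key key _≟_ classes-xs
      where
      same-key-as-x : All (λ b → key x ≡ key b → R x b) xs
      same-key-as-x = All.map (λ R⇐ x≡b → R⇐ (sym x≡b)) (All-filter⁻ (λ a → key a ≟ key x)
        (AllPairs.head (subst (AllPairs R) (filter-accept (λ a → key a ≟ key x) refl) (classes (key x)))))
      classes-xs : ∀ c → AllPairs R (filter (λ a → key a ≟ c) xs)
      classes-xs c with key x ≟ c
      ... | yes x≡c = AllPairs.tail (subst (AllPairs R) (filter-accept (λ a → key a ≟ c) x≡c) (classes c))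
      ... | no x≢c = subst (AllPairs R) (filter-reject (λ a → key a ≟ c) x≢c) (classes c)

  module _ {A : Set} where

    lookup-injective : {xs : List A} → AllPairs (λ a b → ¬ a ≡ b) xs → Injective _≡_ _≡_ (List.lookup xs)
    lookup-injective (_ ∷ _) {zero} {zero} _ = refl
    lookup-injective (x≢ ∷ _) {zero} {suc j} eq = ⊥-elim (All.lookup x≢ (∈-lookup j) eq)
    lookup-injective (x≢ ∷ _) {suc i} {zero} eq = ⊥-elim (All.lookup x≢ (∈-lookup i) (sym eq))
    lookup-injective (_ ∷ xs≢) {suc i} {suc j} eq = cong suc (lookup-injective xs≢ eq)

    two-members⇒2≤length : ∀ {a b : A} {xs} → a ∈ xs → b ∈ xs → ¬ a ≡ b → 2 ≤ length xs
    two-members⇒2≤length (here refl) (here refl) a≢b = ⊥-elim (a≢b refl)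
    two-members⇒2≤length (here refl) (there b∈) _ = s≤s (∈-length b∈)
    two-members⇒2≤length (there a∈) (here refl) _ = s≤s (∈-length a∈)
    two-members⇒2≤length (there a∈) (there b∈) a≢b = m≤n⇒m≤1+n (two-members⇒2≤length a∈ b∈ a≢b)

  distinct⇒length≤ : ∀ {m} (xs : List (Fin m)) → AllPairs (λ a b → ¬ a ≡ b) xs → length xs ≤ m
  distinct⇒length≤ xs xs≢ = injective⇒≤ (lookup-injective xs≢)

module Matching where

  open import Defs
  open Counting
  open Lists using (two-members⇒2≤length)
  open import Data.Nat using (ℕ; zero; suc; _+_; _≤_; s≤s⁻¹)
  open import Data.Nat.Properties hiding (_≟_)
  open import Data.Fin using (Fin; zero; _≟_)
  open import Data.Fin.Subset using (Subset; _∈_; _∉_; ⁅_⁆; ∣_∣)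
  open import Data.Fin.Subset.Properties using (_∈?_; x∈p∪q⁺; x∈p∪q⁻; p⊆p∪q; x∈⁅x⁆; x∈⁅y⁆⇒x≡y; ∣⁅x⁆∣≡1; p⊆q⇒∣p∣≤∣q∣)
  open import Data.List.Membership.Propositional.Properties using (∈-allFin; ∈-filter⁺)
  open import Data.Product using (∃-syntax; _×_; _,_; proj₁)
  open import Data.Sum using (_⊎_; inj₁; inj₂)
  open import Data.Unit using (⊤; tt)
  open import Data.Empty using (⊥-elim)
  open import Relation.Nullary using (yes; no; ¬_)
  open import Relation.Binary.PropositionalEquality

  module _ {L R : ℕ} where

    addEdge-≢ : ∀ (M : EdgeSet L R) x j {x′} → ¬ x′ ≡ x → addEdge M x j x′ ≡ M x′
    addEdge-≢ M x j {x′} x′≢x with x′ ≟ x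
    ... | yes x′≡x = ⊥-elim (x′≢x x′≡x)
    ... | no _ = refl

    ∈-addEdge : ∀ (M : EdgeSet L R) x j → j ∈ addEdge M x j x
    ∈-addEdge M x j with x ≟ x
    ... | yes _ = x∈p∪q⁺ (inj₂ (x∈⁅x⁆ j))
    ... | no x≢x = ⊥-elim (x≢x refl)

    ⊆-addEdge : ∀ (M : EdgeSet L R) x j → M ⊆ₑ addEdge M x j
    ⊆-addEdge M x j x′ with x′ ≟ x
    ... | yes _ = p⊆p∪q _
    ... | no _ = λ j∈ → j∈

    addEdge-mono : ∀ {M M′ : EdgeSet L R} x j → M ⊆ₑ M′ → addEdge M x j ⊆ₑ addEdge M′ x j
    addEdge-mono {M} x j M⊆M′ x′ with x′ ≟ x
    ... | no _ = M⊆M′ x′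
    ... | yes _ = λ j∈ → x∈p∪q⁺ (Data.Sum.map₁ (M⊆M′ x′) (x∈p∪q⁻ (M x′) _ j∈))

    ∈-addEdge⁻ : ∀ (M : EdgeSet L R) x j {x′ j′} → j′ ∈ addEdge M x j x′ → j′ ∈ M x′ ⊎ (x′ ≡ x × j′ ≡ j)
    ∈-addEdge⁻ M x j {x′} j′∈ with x′ ≟ x
    ... | no _ = inj₁ j′∈
    ... | yes x′≡x with x∈p∪q⁻ (M x′) ⁅ j ⁆ j′∈
    ...   | inj₁ j′∈M = inj₁ j′∈M
    ...   | inj₂ j′∈⁅j⁆ = inj₂ (x′≡x , x∈⁅y⁆⇒x≡y j j′∈⁅j⁆)

    #edges≡∑ : (M : EdgeSet L R) → #edges M ≡ ∑ (λ x → ∣ M x ∣)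
    #edges≡∑ M = sum-map-allFin L (λ x → ∣ M x ∣)

    #edges-addEdge : ∀ (M : EdgeSet L R) x j → #edges (addEdge M x j) ≤ suc (#edges M)
    #edges-addEdge M x j = begin
      #edges (addEdge M x j)                              ≡⟨ #edges≡∑ (addEdge M x j) ⟩
      ∑ (λ x′ → ∣ addEdge M x j x′ ∣)                     ≤⟨ ∑-mono ∣addEdge∣≤ ⟩
      ∑ (λ x′ → ∣ M x′ ∣ + ⟦ x′ ≟ x ⟧)                    ≡⟨ ∑-distrib-+ (λ x′ → ∣ M x′ ∣) (λ x′ → ⟦ x′ ≟ x ⟧) ⟩
      ∑ (λ x′ → ∣ M x′ ∣) + ∑ (λ x′ → ⟦ x′ ≟ x ⟧)         ≡⟨ cong₂ _+_ (sym (#edges≡∑ M)) (∑-indicator x) ⟩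
      #edges M + 1                                        ≡⟨ +-comm (#edges M) 1 ⟩
      suc (#edges M)                                      ∎
      where
      open ≤-Reasoning
      ∣addEdge∣≤ : ∀ x′ → ∣ addEdge M x j x′ ∣ ≤ ∣ M x′ ∣ + ⟦ x′ ≟ x ⟧
      ∣addEdge∣≤ x′ with x′ ≟ x
      ... | yes _ = ≤-trans (∣p∪q∣≤∣p∣+∣q∣ (M x′) ⁅ j ⁆) (≤-reflexive (cong (∣ M x′ ∣ +_) (∣⁅x⁆∣≡1 j)))
      ... | no _ = ≤-reflexive (sym (+-identityʳ _))

    #edges≡0⇒∉ : ∀ (M : EdgeSet L R) → #edges M ≡ 0 → ∀ x j → j ∉ M x
    #edges≡0⇒∉ M #M≡0 x j j∈ = 1+n≰n (begin
      1                      ≡⟨ ∣⁅x⁆∣≡1 j ⟨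
      ∣ ⁅ j ⁆ ∣              ≤⟨ p⊆q⇒∣p∣≤∣q∣ (λ j′∈ → subst (_∈ M x) (sym (x∈⁅y⁆⇒x≡y j j′∈)) j∈) ⟩
      ∣ M x ∣                ≤⟨ ∑-term≤ (λ x′ → ∣ M x′ ∣) x ⟩
      ∑ (λ x′ → ∣ M x′ ∣)    ≡⟨ #edges≡∑ M ⟨
      #edges M               ≡⟨ #M≡0 ⟩
      0                      ∎)
      where open ≤-Reasoning

  Respond : ∀ {L R} → BipGraph L R → ℕ → (EdgeSet L R → Set) → Set
  Respond {L} {R} G K Safe =
    ∀ M → Safe M → ∀ (A : EdgeSet L R) → A ⊆ₑ M → suc (#edges A) ≤ K →
    ∀ x → (∀ j → j ∉ A x) →
    ∃[ j ] (j ∈ G x × (∀ x′ → j ∉ A x′) × Safe (addEdge A x j))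

  -- Matcher has to cover x, which has no edge yet, so her edge starts at x; load 1 makes its right node unused.
  DynMatching⇒Respond : ∀ {L R} {G : BipGraph L R} {K} (dm : DynMatching G K) → Respond G K (proj₁ dm)
  DynMatching⇒Respond {L} (Safe , _ , play) M safe A A⊆M #A<K x x-free
    with play M safe A A⊆M #A<K x
  ... | x″ , j , j∈G , (j′ , j′∈) , load≤1 , safe′ with ∈-addEdge⁻ A x″ j j′∈
  ...   | inj₁ j′∈A = ⊥-elim (x-free j′ j′∈A)
  ...   | inj₂ (refl , _) = j , j∈G , j-unused , safe′
    where
    j-unused : ∀ x′ → j ∉ A x′
    j-unused x′ j∈ with x′ ≟ x
    ... | yes refl = x-free j j∈
    ... | no x′≢x = <-irrefl refl (≤-trans
      (two-members⇒2≤length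
        (∈-filter⁺ (λ z → j ∈? addEdge A x j z) (∈-allFin x) (∈-addEdge A x j))
        (∈-filter⁺ (λ z → j ∈? addEdge A x j z) (∈-allFin x′) (subst (j ∈_) (sym (addEdge-≢ A x j x′≢x)) j∈))
        (λ x≡x′ → x′≢x (sym x≡x′)))
      (load≤1 j))

  star-respond : ∀ {L} → Respond {L} {1} (λ _ → ⁅ zero ⁆) 1 (λ _ → ⊤)
  star-respond M _ A _ #A<1 x _ =
    zero , x∈⁅x⁆ zero , (λ x′ → #edges≡0⇒∉ A (n≤0⇒n≡0 (s≤s⁻¹ #A<1)) x′ zero) , tt

  empty-respond : ∀ {R} (G : BipGraph 0 R) K Safe → Respond G K Safe
  empty-respond G K Safe M _ A _ _ ()

module Layered where

  open import Defs
  open Counting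
  open Matching using (Respond)
  open import Data.Nat using (ℕ; zero; suc; _+_; _*_; _≤_; _^_)
  open import Data.Nat.Properties hiding (_≟_)
  open import Algebra.Properties.CommutativeSemigroup +-commutativeSemigroup using () renaming (interchange to +-interchange)
  open import Data.Fin using (Fin; zero; suc; _↑ˡ_; _↑ʳ_; combine; remQuot; splitAt; inject≤; join)
  open import Data.Fin.Properties
    using (splitAt-↑ˡ; splitAt-↑ʳ; remQuot-combine; combine-remQuot; join-splitAt; any?; inject≤-injective)
  import Data.Fin.Properties as Fin
  open import Data.Fin.Subset using (Subset; _∈_; ∣_∣)
  open import Data.Fin.Subset.Properties using (_∈?_)
  open import Data.Product using (∃-syntax; _×_; _,_; proj₁; proj₂; map₂)
  import Data.Product.Properties as Product
  open import Data.Sum using (_⊎_; inj₁; inj₂; [_,_]′)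
  import Data.Sum.Properties as Sum
  open import Data.Unit using (⊤; tt)
  open import Data.Empty using (⊥)
  open import Function using (_∘_)
  open import Relation.Nullary using (Dec; yes; no)
  open import Relation.Nullary.Decidable using (_×-dec_)
  open import Relation.Binary.PropositionalEquality

  record Layer (K : ℕ) : Set₁ where
    field
      left right : ℕ
      graph      : BipGraph left right
      Safe       : EdgeSet left right → Set
      safe-empty : Safe emptyEdges
      respond    : Respond graph K Safe

  -- Layer c is played in each copy of the depth-c network, which has n^c outputs.
  record Tower (n : ℕ) : Set₁ where
    field
      layer      : ∀ c → Layer (n ^ c)
      right≤left : ∀ c → Layer.right (layer (suc c)) ≤ Layer.left (layer c)

  module Construction {n : ℕ} (T : Tower n) where

    open Tower T

    left right : ℕ → ℕ
    left c = Layer.left (layer c)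
    right c = Layer.right (layer c)

    graph : ∀ c → BipGraph (left c) (right c)
    graph c = Layer.graph (layer c)

    Node : ℕ → Set
    Node zero = ⊤
    Node (suc k) = Fin (left k) ⊎ (Fin n × Node k)

    size : ℕ → ℕ
    size zero = 1
    size (suc k) = left k + n * size k

    enc : ∀ k → Node k → Fin (size k)
    enc zero tt = zero
    enc (suc k) (inj₁ i) = i ↑ˡ (n * size k)
    enc (suc k) (inj₂ (d , w)) = left k ↑ʳ combine {n} d (enc k w)

    dec : ∀ k → Fin (size k) → Node k
    dec zero _ = tt
    dec (suc k) u = [ inj₁ , inj₂ ∘ map₂ (dec k) ∘ remQuot {n} (size k) ]′ (splitAt (left k) u)

    dec-↑ʳ : ∀ k d w → dec (suc k) (left k ↑ʳ combine d w) ≡ inj₂ (d , dec k w)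
    dec-↑ʳ k d w rewrite splitAt-↑ʳ (left k) (n * size k) (combine d w) =
      cong (inj₂ ∘ map₂ (dec k)) (remQuot-combine {n} {size k} d w)

    dec-enc : ∀ k a → dec k (enc k a) ≡ a
    dec-enc zero tt = refl
    dec-enc (suc k) (inj₁ i) rewrite splitAt-↑ˡ (left k) i (n * size k) = refl
    dec-enc (suc k) (inj₂ (d , w)) = trans (dec-↑ʳ k d (enc k w)) (cong (λ w′ → inj₂ (d , w′)) (dec-enc k w))

    enc-dec : ∀ k u → enc k (dec k u) ≡ u
    enc-dec zero zero = refl
    enc-dec (suc k) u with splitAt (left k) u in eq
    ... | inj₁ i = trans (cong (join (left k) (n * size k)) (sym eq)) (join-splitAt (left k) (n * size k) u)
    ... | inj₂ x = begin
      left k ↑ʳ combine d (enc k (dec k w)) ≡⟨ cong (λ w′ → left k ↑ʳ combine d w′) (enc-dec k w) ⟩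
      left k ↑ʳ combine d w                 ≡⟨ cong (left k ↑ʳ_) (combine-remQuot {n} (size k) x) ⟩
      join (left k) (n * size k) (inj₂ x)  ≡⟨ cong (join (left k) (n * size k)) (sym eq) ⟩
      join (left k) (n * size k) (splitAt (left k) u) ≡⟨ join-splitAt (left k) (n * size k) u ⟩
      u                                     ∎
      where
      open ≡-Reasoning
      d : Fin n
      d = proj₁ (remQuot {n} (size k) x)
      w : Fin (size k)
      w = proj₂ (remQuot {n} (size k) x)

    enc-injective : ∀ k {a b} → enc k a ≡ enc k b → a ≡ b
    enc-injective k {a} {b} eq = trans (sym (dec-enc k a)) (trans (cong (dec k) eq) (dec-enc k b))

    dec-injective : ∀ k {u v} → dec k u ≡ dec k v → u ≡ v
    dec-injective k {u} {v} eq = trans (sym (enc-dec k u)) (trans (cong (enc k) eq) (enc-dec k v))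

    _≟N_ : ∀ {k} (a b : Node k) → Dec (a ≡ b)
    _≟N_ {zero} tt tt = yes refl
    _≟N_ {suc k} = Sum.≡-dec Fin._≟_ (Product.≡-dec Fin._≟_ _≟N_)

    entry : ∀ k → Fin (right k) → Node k
    entry zero _ = tt
    entry (suc c) j = inj₁ (inject≤ j (right≤left c))

    entry-injective : ∀ c {j j′} → entry (suc c) j ≡ entry (suc c) j′ → j ≡ j′
    entry-injective c eq = inject≤-injective _ _ _ _ (Sum.inj₁-injective eq)

    IsTop : ∀ k → Node k → Set
    IsTop zero _ = ⊤
    IsTop (suc k) (inj₁ _) = ⊤
    IsTop (suc k) (inj₂ _) = ⊥

    IsTop-entry : ∀ k j → IsTop k (entry k j)
    IsTop-entry zero _ = tt
    IsTop-entry (suc k) _ = tt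

    Edge : ∀ k → Node k → Node k → Set
    Edge zero _ _ = ⊥
    Edge (suc k) (inj₁ i) (inj₂ (_ , w)) = ∃[ j ] (j ∈ graph k i × w ≡ entry k j)
    Edge (suc k) (inj₂ (d , w)) (inj₂ (d′ , w′)) = d ≡ d′ × Edge k w w′
    Edge (suc k) _ (inj₁ _) = ⊥

    edge? : ∀ k a b → Dec (Edge k a b)
    edge? zero _ _ = no λ ()
    edge? (suc k) (inj₁ i) (inj₂ (_ , w)) = any? λ j → (j ∈? graph k i) ×-dec (w ≟N entry k j)
    edge? (suc k) (inj₂ (d , w)) (inj₂ (d′ , w′)) = (d Fin.≟ d′) ×-dec edge? k w w′
    edge? (suc k) (inj₁ _) (inj₁ _) = no λ ()
    edge? (suc k) (inj₂ _) (inj₁ _) = no λ ()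

    E : ∀ k → Fin (size k) → Subset (size k)
    E k u = subset λ v → edge? k (dec k u) (dec k v)

    Edge⇒∈E : ∀ k {a b} → Edge k a b → enc k b ∈ E k (enc k a)
    Edge⇒∈E k {a} {b} a→b = ∈-subset⁺ (λ v → edge? k (dec k (enc k a)) (dec k v))
      (subst₂ (Edge k) (sym (dec-enc k a)) (sym (dec-enc k b)) a→b)

    ∈E⇒Edge : ∀ k {u v} → v ∈ E k u → Edge k (dec k u) (dec k v)
    ∈E⇒Edge k {u} = ∈-subset⁻ (λ v → edge? k (dec k u) (dec k v))

    height : ∀ k → Node k → ℕ
    height zero _ = 0
    height (suc k) (inj₁ _) = suc k
    height (suc k) (inj₂ (_ , w)) = height k w

    height-entry : ∀ k j → height k (entry k j) ≡ k
    height-entry zero _ = refl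
    height-entry (suc k) _ = refl

    Edge⇒height : ∀ k {a b} → Edge k a b → height k a ≡ suc (height k b)
    Edge⇒height (suc k) {inj₁ _} {inj₂ _} (j , _ , refl) = cong suc (sym (height-entry k j))
    Edge⇒height (suc k) {inj₂ _} {inj₂ _} (_ , a→b) = Edge⇒height k a→b

    Path⇒height : ∀ k {u v m} → Path (E k) u v m → height k (dec k u) ≡ m + height k (dec k v)
    Path⇒height k here = refl
    Path⇒height k (step v∈ p) = trans (Edge⇒height k (∈E⇒Edge k v∈)) (cong suc (Path⇒height k p))

    data NodePath (k : ℕ) : Node k → Node k → ℕ → Set where
      here : ∀ {a} → NodePath k a a zero
      step : ∀ {a b c m} → Edge k a b → NodePath k b c m → NodePath k a c (suc m)

    NodePath-inj₂ : ∀ k d {a b m} → NodePath k a b m → NodePath (suc k) (inj₂ (d , a)) (inj₂ (d , b)) m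
    NodePath-inj₂ k d here = here
    NodePath-inj₂ k d (step a→b p) = step (refl , a→b) (NodePath-inj₂ k d p)

    NodePath⇒Path : ∀ k {a b m} → NodePath k a b m → Path (E k) (enc k a) (enc k b) m
    NodePath⇒Path k here = here
    NodePath⇒Path k (step a→b p) = step (Edge⇒∈E k a→b) (NodePath⇒Path k p)

    ∑N : ∀ k → (Node k → ℕ) → ℕ
    ∑N zero f = f tt
    ∑N (suc k) f = ∑ (f ∘ inj₁) + ∑ {n} (λ d → ∑N k (λ w → f (inj₂ (d , w))))

    ∑N-mono : ∀ k {f g : Node k → ℕ} → (∀ a → f a ≤ g a) → ∑N k f ≤ ∑N k g
    ∑N-mono zero f≤g = f≤g tt
    ∑N-mono (suc k) f≤g = +-mono-≤ (∑-mono (f≤g ∘ inj₁)) (∑-mono λ d → ∑N-mono k λ w → f≤g (inj₂ (d , w)))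

    ∑N-cong : ∀ k {f g : Node k → ℕ} → (∀ a → f a ≡ g a) → ∑N k f ≡ ∑N k g
    ∑N-cong zero f≗g = f≗g tt
    ∑N-cong (suc k) f≗g = cong₂ _+_ (∑-cong (f≗g ∘ inj₁)) (∑-cong {n} λ d → ∑N-cong k λ w → f≗g (inj₂ (d , w)))

    ∑N-zero : ∀ k {f : Node k → ℕ} → (∀ a → f a ≡ 0) → ∑N k f ≡ 0
    ∑N-zero zero f≡0 = f≡0 tt
    ∑N-zero (suc k) f≡0 = cong₂ _+_ (∑-zero (f≡0 ∘ inj₁)) (∑-zero {n} λ d → ∑N-zero k λ w → f≡0 (inj₂ (d , w)))

    ∑N-distrib-+ : ∀ k (f g : Node k → ℕ) → ∑N k (λ a → f a + g a) ≡ ∑N k f + ∑N k g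
    ∑N-distrib-+ zero f g = refl
    ∑N-distrib-+ (suc k) f g = trans
      (cong₂ _+_ (∑-distrib-+ (f ∘ inj₁) (g ∘ inj₁))
                 (trans (∑-cong {n} λ d → ∑N-distrib-+ k (f ∘ inj₂ ∘ (d ,_)) (g ∘ inj₂ ∘ (d ,_)))
                        (∑-distrib-+ {n} (λ d → ∑N k (f ∘ inj₂ ∘ (d ,_))) (λ d → ∑N k (g ∘ inj₂ ∘ (d ,_))))))
      (+-interchange (∑ (f ∘ inj₁)) (∑ (g ∘ inj₁)) _ _)

    ∑N-indicator : ∀ k (a : Node k) → ∑N k (λ b → ⟦ b ≟N a ⟧) ≡ 1
    ∑N-indicator zero tt = refl
    ∑N-indicator (suc k) (inj₁ i) = cong₂ _+_ (∑-indicator i) (∑-zero {n} λ _ → ∑N-zero k λ _ → refl)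
    ∑N-indicator (suc k) (inj₂ (d , w)) =
      cong₂ _+_ (∑-zero {left k} λ _ → refl) (trans (∑-cong {n} copy) (∑-indicator-* d 1))
      where
      copy : ∀ d′ → ∑N k (λ w′ → ⟦ inj₂ (d′ , w′) ≟N inj₂ (d , w) ⟧) ≡ ⟦ d′ Fin.≟ d ⟧ * 1
      copy d′ = by-cases (d′ Fin.≟ d)
        where
        by-cases : (d′≟d : Dec (d′ ≡ d)) → ∑N k (λ w′ → ⟦ inj₂ (d′ , w′) ≟N inj₂ (d , w) ⟧) ≡ ⟦ d′≟d ⟧ * 1
        by-cases (yes refl) = trans (∑N-cong k λ w′ → ⟦⟧-cong (inj₂ (d , w′) ≟N inj₂ (d , w)) (w′ ≟N w)
                                                      (λ { refl → refl }) (cong λ w″ → inj₂ (d , w″)))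
                                    (∑N-indicator k w)
        by-cases (no d′≢d) = ∑N-zero k λ w′ → ⟦⟧-no (inj₂ (d′ , w′) ≟N inj₂ (d , w)) λ { refl → d′≢d refl }

    ∑-dec : ∀ k (f : Node k → ℕ) → ∑ (f ∘ dec k) ≡ ∑N k f
    ∑-dec zero f = +-identityʳ (f tt)
    ∑-dec (suc k) f = begin
      ∑ (f ∘ dec (suc k))
        ≡⟨ ∑-↑ (left k) (f ∘ dec (suc k)) ⟩
      ∑ (λ i → f (dec (suc k) (i ↑ˡ (n * size k)))) + ∑ (λ x → f (dec (suc k) (left k ↑ʳ x)))
        ≡⟨ cong₂ _+_ (∑-cong {left k} λ i → cong f (dec-enc (suc k) (inj₁ i))) (∑-combine n _) ⟩
      ∑ (f ∘ inj₁) + ∑ {n} (λ d → ∑ (λ w → f (dec (suc k) (left k ↑ʳ combine d w))))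
        ≡⟨ cong (∑ (f ∘ inj₁) +_) (∑-cong λ d → trans (∑-cong λ w → cong f (dec-↑ʳ k d w)) (∑-dec k _)) ⟩
      ∑N (suc k) f ∎
      where open ≡-Reasoning

    degree : ∀ k → Node k → ℕ
    degree k a = ∑N k (λ b → ⟦ edge? k a b ⟧)

    ∣E∣≡degree : ∀ k u → ∣ E k u ∣ ≡ degree k (dec k u)
    ∣E∣≡degree k u = trans (∣subset∣≡∑ (λ v → edge? k (dec k u) (dec k v))) (∑-dec k (λ b → ⟦ edge? k (dec k u) b ⟧))

    ∑N-image : ∀ k {r p} {Q : Fin r → Set p} (Q? : ∀ j → Dec (Q j)) (f : Fin r → Node k) →
               ∑N k (λ w → ⟦ any? (λ j → Q? j ×-dec (w ≟N f j)) ⟧) ≤ ∑ (λ j → ⟦ Q? j ⟧)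
    ∑N-image k {zero} Q? f = ≤-reflexive (∑N-zero k λ _ → refl)
    ∑N-image k {suc r} Q? f = begin
      ∑N k (λ w → ⟦ any? (λ j → Q? j ×-dec (w ≟N f j)) ⟧)
        ≤⟨ ∑N-mono k (λ w → ⟦any?⟧≤ (λ j → Q? j ×-dec (w ≟N f j))) ⟩
      ∑N k (λ w → ⟦ Q? zero ×-dec (w ≟N f zero) ⟧ + ⟦ any? (λ j → Q? (suc j) ×-dec (w ≟N f (suc j))) ⟧)
        ≡⟨ ∑N-distrib-+ k _ _ ⟩
      ∑N k (λ w → ⟦ Q? zero ×-dec (w ≟N f zero) ⟧) + ∑N k (λ w → ⟦ any? (λ j → Q? (suc j) ×-dec (w ≟N f (suc j))) ⟧)
        ≤⟨ +-mono-≤ hit-f0 (∑N-image k (Q? ∘ suc) (f ∘ suc)) ⟩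
      ⟦ Q? zero ⟧ + ∑ (λ j → ⟦ Q? (suc j) ⟧) ∎
      where
      open ≤-Reasoning
      hit-f0 : ∑N k (λ w → ⟦ Q? zero ×-dec (w ≟N f zero) ⟧) ≤ ⟦ Q? zero ⟧
      hit-f0 with Q? zero
      ... | yes _ = ≤-reflexive (∑N-indicator k (f zero))
      ... | no _ = ≤-reflexive (∑N-zero k λ _ → refl)

    degree-inj₁ : ∀ k i → degree (suc k) (inj₁ i) ≤ n * ∣ graph k i ∣
    degree-inj₁ k i = begin
      degree (suc k) (inj₁ i)
        ≡⟨ cong₂ _+_ (∑-zero {left k} λ _ → refl) refl ⟩
      ∑ {n} (λ _ → ∑N k (λ w → ⟦ any? (λ j → (j ∈? graph k i) ×-dec (w ≟N entry k j)) ⟧))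
        ≤⟨ ∑-mono {n} (λ _ → ∑N-image k (_∈? graph k i) (entry k)) ⟩
      ∑ {n} (λ _ → ∑ (λ j → ⟦ j ∈? graph k i ⟧))
        ≡⟨ ∑-const {n} _ ⟩
      n * ∑ (λ j → ⟦ j ∈? graph k i ⟧)
        ≡⟨ cong (n *_) (∣p∣≡∑∈ (graph k i)) ⟨
      n * ∣ graph k i ∣ ∎
      where open ≤-Reasoning

    degree-inj₂ : ∀ k d w → degree (suc k) (inj₂ (d , w)) ≡ degree k w
    degree-inj₂ k d w = trans (cong₂ _+_ (∑-zero {left k} λ _ → refl) refl)
      (trans (∑-cong {n} copy) (∑-indicator-* d (degree k w)))
      where
      copy : ∀ d′ → ∑N k (λ b → ⟦ (d Fin.≟ d′) ×-dec edge? k w b ⟧) ≡ ⟦ d′ Fin.≟ d ⟧ * degree k w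
      copy d′ = by-cases (d′ Fin.≟ d)
        where
        by-cases : (d′≟d : Dec (d′ ≡ d)) → ∑N k (λ b → ⟦ (d Fin.≟ d′) ×-dec edge? k w b ⟧) ≡ ⟦ d′≟d ⟧ * degree k w
        by-cases (yes refl) = trans (∑N-cong k λ b → ⟦⟧-cong ((d Fin.≟ d) ×-dec edge? k w b) (edge? k w b) proj₂ (refl ,_))
                                    (sym (+-identityʳ _))
        by-cases (no d′≢d) = ∑N-zero k λ b → ⟦⟧-no ((d Fin.≟ d′) ×-dec edge? k w b) λ (d≡d′ , _) → d′≢d (sym d≡d′)

    edges : ℕ → ℕ
    edges k = ∑N k (degree k)

    ∑∣E∣≡edges : ∀ k → ∑ (λ u → ∣ E k u ∣) ≡ edges k
    ∑∣E∣≡edges k = trans (∑-cong (∣E∣≡degree k)) (∑-dec k (degree k))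

    edges-suc : ∀ k → edges (suc k) ≤ n * ∑ (λ i → ∣ graph k i ∣) + n * edges k
    edges-suc k = begin
      edges (suc k)
        ≤⟨ +-mono-≤ (∑-mono (degree-inj₁ k)) (≤-reflexive (∑-cong {n} λ d → ∑N-cong k (degree-inj₂ k d))) ⟩
      ∑ (λ i → n * ∣ graph k i ∣) + ∑ {n} (λ _ → edges k)
        ≡⟨ cong₂ _+_ (trans (∑-cong λ i → *-comm n ∣ graph k i ∣) (trans (∑-*ʳ {left k} (λ i → ∣ graph k i ∣) n) (*-comm _ n)))
                     (∑-const {n} _) ⟩
      n * ∑ (λ i → ∣ graph k i ∣) + n * edges k ∎
      where open ≤-Reasoning

module Routes {n : ℕ} (T : Layered.Tower n) where

  open Layered
  open Construction T
  open import Data.Nat using (ℕ; zero; suc; _^_)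
  open import Data.Fin using (Fin; zero; combine; remQuot)
  open import Data.Fin.Properties using (_≟_; remQuot-combine; combine-remQuot)
  open import Data.Fin.Subset using (_∈_)
  open import Data.Product using (∃-syntax; _×_; _,_; proj₁; proj₂; map₂)
  open import Data.Sum using (_⊎_; inj₁; inj₂)
  import Data.Sum.Properties as Sum
  open import Data.Unit using (⊤; tt)
  open import Data.Empty using (⊥; ⊥-elim)
  open import Function using (_∘_)
  open import Relation.Nullary using (Dec; no; ¬_)
  open import Relation.Nullary.Decidable using (_×-dec_)
  open import Relation.Binary.PropositionalEquality

  data Route : ∀ k → Node k → Set where
    stop : Route zero tt
    hop  : ∀ {k} i (d : Fin n) j → j ∈ graph k i → Route k (entry k j) → Route (suc k) (inj₁ i)

  output : ∀ {k a} → Route k a → Fin (n ^ k)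
  output stop = zero
  output (hop _ d _ _ r) = combine d (output r)

  outNode : ∀ k → Fin (n ^ k) → Node k
  outNode zero _ = tt
  outNode (suc k) y = inj₂ (map₂ (outNode k) (remQuot {n} (n ^ k) y))

  outNode-combine : ∀ k d y → outNode (suc k) (combine d y) ≡ inj₂ (d , outNode k y)
  outNode-combine k d y = cong (inj₂ ∘ map₂ (outNode k)) (remQuot-combine {n} {n ^ k} d y)

  outNode-injective : ∀ k {y y′} → outNode k y ≡ outNode k y′ → y ≡ y′
  outNode-injective zero {zero} {zero} _ = refl
  outNode-injective (suc k) {y} {y′} eq = trans (sym (combine-remQuot {n} (n ^ k) y))
    (trans (cong₂ combine (cong proj₁ digits≡) (outNode-injective k (cong proj₂ digits≡)))
           (combine-remQuot {n} (n ^ k) y′))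
    where
    digits≡ : map₂ (outNode k) (remQuot {n} (n ^ k) y) ≡ map₂ (outNode k) (remQuot {n} (n ^ k) y′)
    digits≡ = Sum.inj₂-injective eq

  height-outNode : ∀ k y → height k (outNode k y) ≡ 0
  height-outNode zero _ = refl
  height-outNode (suc k) _ = height-outNode k _

  RouteEdge : ∀ {k a} → Route k a → Node k → Node k → Set
  RouteEdge stop _ _ = ⊥
  RouteEdge {suc k} (hop i d j _ _) (inj₁ i′) (inj₂ (d′ , w)) = i′ ≡ i × d′ ≡ d × w ≡ entry k j
  RouteEdge (hop _ d _ _ r) (inj₂ (d₁ , w)) (inj₂ (d₂ , w′)) = d₁ ≡ d × d₂ ≡ d × RouteEdge r w w′
  RouteEdge (hop _ _ _ _ _) _ (inj₁ _) = ⊥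

  routeEdge? : ∀ {k a} (r : Route k a) b c → Dec (RouteEdge r b c)
  routeEdge? stop _ _ = no λ ()
  routeEdge? {suc k} (hop i d j _ _) (inj₁ i′) (inj₂ (d′ , w)) = (i′ ≟ i) ×-dec ((d′ ≟ d) ×-dec (w ≟N entry k j))
  routeEdge? (hop _ d _ _ r) (inj₂ (d₁ , w)) (inj₂ (d₂ , w′)) = (d₁ ≟ d) ×-dec ((d₂ ≟ d) ×-dec routeEdge? r w w′)
  routeEdge? (hop _ _ _ _ _) (inj₁ _) (inj₁ _) = no λ ()
  routeEdge? (hop _ _ _ _ _) (inj₂ _) (inj₁ _) = no λ ()

  OnRoute : ∀ {k a} → Route k a → Node k → Set
  OnRoute stop _ = ⊤
  OnRoute (hop i _ _ _ _) (inj₁ i′) = i′ ≡ i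
  OnRoute (hop _ d _ _ r) (inj₂ (d′ , w)) = d′ ≡ d × OnRoute r w

  OnRoute-start : ∀ {k a} (r : Route k a) → OnRoute r a
  OnRoute-start stop = tt
  OnRoute-start (hop i d j _ r) = refl

  OnRoute-output : ∀ {k a} (r : Route k a) → OnRoute r (outNode k (output r))
  OnRoute-output stop = tt
  OnRoute-output {suc k} (hop i d j j∈ r) =
    subst (OnRoute (hop i d j j∈ r)) (sym (outNode-combine k d (output r))) (refl , OnRoute-output r)

  RouteEdge⇒Edge : ∀ {k a} (r : Route k a) {b c} → RouteEdge r b c → Edge k b c
  RouteEdge⇒Edge (hop i d j j∈ r) {inj₁ _} {inj₂ _} (refl , refl , w≡) = j , j∈ , w≡
  RouteEdge⇒Edge (hop i d j _ r) {inj₂ _} {inj₂ _} (refl , refl , b→c) = refl , RouteEdge⇒Edge r b→c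

  RouteEdge⇒OnRouteˡ : ∀ {k a} (r : Route k a) {b c} → RouteEdge r b c → OnRoute r b
  RouteEdge⇒OnRouteˡ (hop i d j _ r) {inj₁ _} {inj₂ _} (i′≡i , _) = i′≡i
  RouteEdge⇒OnRouteˡ (hop i d j _ r) {inj₂ _} {inj₂ _} (d₁≡d , _ , b→c) = d₁≡d , RouteEdge⇒OnRouteˡ r b→c

  RouteEdge⇒OnRouteʳ : ∀ {k a} (r : Route k a) {b c} → RouteEdge r b c → OnRoute r c
  RouteEdge⇒OnRouteʳ (hop i d j _ r) {inj₁ _} {inj₂ _} (_ , d′≡d , refl) = d′≡d , OnRoute-start r
  RouteEdge⇒OnRouteʳ (hop i d j _ r) {inj₂ _} {inj₂ _} (_ , d₂≡d , b→c) = d₂≡d , RouteEdge⇒OnRouteʳ r b→c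

  OnRoute⇒start⊎RouteEdge : ∀ {k a} (r : Route k a) {b} → OnRoute r b → b ≡ a ⊎ ∃[ c ] RouteEdge r c b
  OnRoute⇒start⊎RouteEdge stop {tt} _ = inj₁ refl
  OnRoute⇒start⊎RouteEdge (hop i d j _ r) {inj₁ _} refl = inj₁ refl
  OnRoute⇒start⊎RouteEdge (hop i d j _ r) {inj₂ (_ , w)} (d′≡d , on) with OnRoute⇒start⊎RouteEdge r on
  ... | inj₁ refl = inj₂ (inj₁ i , refl , d′≡d , refl)
  ... | inj₂ (c , c→w) = inj₂ (inj₂ (d , c) , refl , d′≡d , c→w)

  ¬RouteEdge-start : ∀ {k a} (r : Route k a) b → ¬ RouteEdge r b a
  ¬RouteEdge-start (hop i d j _ r) (inj₁ _) ()
  ¬RouteEdge-start (hop i d j _ r) (inj₂ _) ()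

  ¬RouteEdge-output : ∀ {k a} (r : Route k a) b → ¬ RouteEdge r (outNode k (output r)) b
  ¬RouteEdge-output {suc k} (hop i d j j∈ r) b =
    subst (λ a → ¬ RouteEdge (hop i d j j∈ r) a b) (sym (outNode-combine k d (output r))) (below b)
    where
    below : ∀ b → ¬ RouteEdge (hop i d j j∈ r) (inj₂ (d , outNode k (output r))) b
    below (inj₂ (_ , w)) (_ , _ , out→w) = ¬RouteEdge-output r w out→w

  RouteEdge-injectiveˡ : ∀ {k a} (r : Route k a) {b b′ c} → RouteEdge r b c → RouteEdge r b′ c → b ≡ b′
  RouteEdge-injectiveˡ (hop i d j _ r) {inj₁ _} {inj₁ _} {inj₂ _} (refl , _) (refl , _) = refl
  RouteEdge-injectiveˡ (hop i d j _ r) {inj₁ _} {inj₂ (_ , w)} {inj₂ _} (_ , _ , refl) (_ , _ , w→) =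
    ⊥-elim (¬RouteEdge-start r w w→)
  RouteEdge-injectiveˡ (hop i d j _ r) {inj₂ (_ , w)} {inj₁ _} {inj₂ _} (_ , _ , w→) (_ , _ , refl) =
    ⊥-elim (¬RouteEdge-start r w w→)
  RouteEdge-injectiveˡ (hop i d j _ r) {inj₂ (d₁ , w)} {inj₂ (d₁′ , w′)} {inj₂ _} (refl , _ , w→) (refl , _ , w′→) =
    cong (λ w → inj₂ (d , w)) (RouteEdge-injectiveˡ r w→ w′→)

  terminal⇒output : ∀ {k a} (r : Route k a) {b} → OnRoute r b → (∀ c → ¬ RouteEdge r b c) → b ≡ outNode k (output r)
  terminal⇒output stop {tt} _ _ = refl
  terminal⇒output {suc k} (hop i d j _ r) {inj₁ _} refl terminal =
    ⊥-elim (terminal (inj₂ (d , entry k j)) (refl , refl , refl))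
  terminal⇒output {suc k} (hop i d j j∈ r) {inj₂ (d′ , w)} (refl , on) terminal = begin
    inj₂ (d , w)
      ≡⟨ cong (λ w → inj₂ (d , w)) (terminal⇒output r on λ c w→c → terminal (inj₂ (d , c)) (refl , refl , w→c)) ⟩
    inj₂ (d , outNode k (output r))
      ≡⟨ outNode-combine k d (output r) ⟨
    outNode (suc k) (output (hop i d j j∈ r)) ∎
    where open ≡-Reasoning

  Route⇒NodePath : ∀ {k a} (r : Route k a) → NodePath k a (outNode k (output r)) k
  Route⇒NodePath stop = here
  Route⇒NodePath {suc k} (hop i d j j∈ r) =
    subst (λ b → NodePath (suc k) (inj₁ i) b (suc k)) (sym (outNode-combine k d (output r)))
    (step (j , j∈ , refl) (NodePath-inj₂ k d (Route⇒NodePath r)))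

module Strategy {n : ℕ} (T : Layered.Tower n) where

  open import Defs
  open Counting
  open Lists
  open Matching using (#edges≡∑; #edges-addEdge; ⊆-addEdge; addEdge-mono; addEdge-≢)
  open Layered
  open Tower T
  open Construction T
  open Routes T
  open import Data.Nat using (zero; suc; _≤_; _^_; s≤s)
  open import Data.Nat.Properties using (≤-trans; ≤-reflexive; module ≤-Reasoning)
  open import Data.Fin using (Fin; zero; combine; remQuot)
  open import Data.Fin.Properties using (_≟_; combine-remQuot)
  open import Data.Fin.Subset using (_∈_; _∉_)
  open import Data.Fin.Subset.Properties using (∉⊥; ∣⊥∣≡0)
  open import Data.List using (List; []; _∷_; length; map; filter)
  open import Data.List.Properties using (length-map)
  open import Data.List.Relation.Unary.All as All using (All; []; _∷_)
  open import Data.List.Relation.Unary.All.Properties using (all-filter; filter⁺) renaming (map⁺ to All-map⁺)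
  open import Data.List.Relation.Unary.AllPairs as AllPairs using (AllPairs; []; _∷_)
  open import Data.List.Relation.Unary.AllPairs.Properties using () renaming (map⁺ to AllPairs-map⁺; map⁻ to AllPairs-map⁻)
  open import Data.List.Relation.Binary.Sublist.Propositional using ([]; _∷_; _∷ʳ_) renaming (_⊆_ to _⊑_)
  open import Data.List.Relation.Binary.Sublist.Propositional.Properties using () renaming (filter⁺ to filter-⊑; map⁺ to map-⊑)
  open import Data.Product using (∃; ∃-syntax; _×_; _,_; proj₁; proj₂)
  open import Data.Sum using (inj₁; inj₂)
  open import Data.Unit using (tt)
  open import Data.Empty using (⊥-elim)
  open import Function using (_∘_)
  open import Relation.Nullary using (yes; no; ¬_)
  open import Relation.Binary.PropositionalEquality

  Routed : ℕ → Set
  Routed k = ∃ (Route k)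

  start : ∀ {k} → Routed k → Node k
  start = proj₁

  target : ∀ {k} → Routed k → Fin (n ^ k)
  target (_ , r) = output r

  Apart : ∀ {k} → Routed k → Routed k → Set
  Apart a b = ¬ start a ≡ start b × ¬ target a ≡ target b

  Disjoint : ∀ {k} → Routed k → Routed k → Set
  Disjoint (_ , r) (_ , r′) = ∀ b → ¬ (OnRoute r b × OnRoute r′ b)

  module _ {k : ℕ} where

    digit : Routed (suc k) → Fin n
    digit (_ , hop _ d _ _ _) = d

    top : Routed (suc k) → Fin (left k)
    top (_ , hop i _ _ _ _) = i

    firstRight : Routed (suc k) → Fin (right k)
    firstRight (_ , hop _ _ j _ _) = j

    rest : Routed (suc k) → Routed k
    rest (_ , hop _ _ j _ r) = entry k j , r

    start≡top : ∀ a → start a ≡ inj₁ (top a)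
    start≡top (_ , hop _ _ _ _ _) = refl

    start-rest : ∀ a → start (rest a) ≡ entry k (firstRight a)
    start-rest (_ , hop _ _ _ _ _) = refl

    target≡combine : ∀ a → target a ≡ combine (digit a) (target (rest a))
    target≡combine (_ , hop _ _ _ _ _) = refl

    inCopy : Fin n → List (Routed (suc k)) → List (Routed (suc k))
    inCopy d = filter λ a → digit a ≟ d

    usedEdges : List (Routed (suc k)) → EdgeSet (left k) (right k)
    usedEdges [] = emptyEdges
    usedEdges (a ∷ as) = addEdge (usedEdges as) (top a) (firstRight a)

    #usedEdges≤length : ∀ as → #edges (usedEdges as) ≤ length as
    #usedEdges≤length [] =
      ≤-reflexive (trans (#edges≡∑ (emptyEdges {left k} {right k})) (∑-zero {left k} λ _ → ∣⊥∣≡0 (right k)))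
    #usedEdges≤length (a ∷ as) = ≤-trans (#edges-addEdge (usedEdges as) (top a) (firstRight a)) (s≤s (#usedEdges≤length as))

    usedEdges-mono : ∀ {as bs} → as ⊑ bs → usedEdges as ⊆ₑ usedEdges bs
    usedEdges-mono [] x j∈ = j∈
    usedEdges-mono {as} {b ∷ bs} (b ∷ʳ as⊑bs) x j∈ =
      ⊆-addEdge (usedEdges bs) (top b) (firstRight b) x (usedEdges-mono as⊑bs x j∈)
    usedEdges-mono (refl ∷ as⊑bs) = addEdge-mono _ _ (usedEdges-mono as⊑bs)

    usedEdges-free : ∀ {i} as → All (λ a → ¬ top a ≡ i) as → ∀ j → j ∉ usedEdges as i
    usedEdges-free [] [] j = ∉⊥
    usedEdges-free (a ∷ as) (a≢ ∷ as≢) j j∈ =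
      usedEdges-free as as≢ j (subst (j ∈_) (addEdge-≢ (usedEdges as) (top a) (firstRight a) (a≢ ∘ sym)) j∈)

    firstRight∈usedEdges : ∀ as → All (λ a → firstRight a ∈ usedEdges as (top a)) as
    firstRight∈usedEdges [] = []
    firstRight∈usedEdges (a ∷ as) = Matching.∈-addEdge (usedEdges as) (top a) (firstRight a)
      ∷ All.map (⊆-addEdge (usedEdges as) (top a) (firstRight a) _) (firstRight∈usedEdges as)

  -- Within copy d, the edges of graph k taken by the routes through that copy stay inside a
  -- position from which Matcher still wins, and the routes continue consistently below.
  BelowSafe : ∀ k → EdgeSet (left k) (right k) → Set
  BelowSafe k A = ∃[ M ] (Layer.Safe (layer k) M × A ⊆ₑ M)

  Consistent : ∀ k → List (Routed k) → Set
  Consistent zero as = AllPairs Apart as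
  Consistent (suc k) as = AllPairs Apart as ×
    (∀ d → BelowSafe k (usedEdges (inCopy d as)) × Consistent k (map rest (inCopy d as)))

  Consistent⇒Apart : ∀ k {as} → Consistent k as → AllPairs Apart as
  Consistent⇒Apart zero apart = apart
  Consistent⇒Apart (suc k) (apart , _) = apart

  Consistent-[] : ∀ k → Consistent k []
  Consistent-[] zero = []
  Consistent-[] (suc k) = [] , λ _ → (emptyEdges , Layer.safe-empty (layer k) , λ _ j∈ → j∈) , Consistent-[] k

  Consistent-⊑ : ∀ k {as bs} → as ⊑ bs → Consistent k bs → Consistent k as
  Consistent-⊑ zero as⊑bs apart = AllPairs-resp-⊑ as⊑bs apart
  Consistent-⊑ (suc k) as⊑bs (apart , copies) = AllPairs-resp-⊑ as⊑bs apart , λ d →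
    let ((M , safe , used⊆M) , below) = copies d
        in-copy = filter-⊑ (λ a → digit a ≟ d) (λ a → digit a ≟ d) (λ { refl p → p }) as⊑bs
    in (M , safe , λ x j∈ → used⊆M x (usedEdges-mono in-copy x j∈)) , Consistent-⊑ k (map-⊑ rest in-copy) below

  Consistent⇒Disjoint : ∀ k {as} → Consistent k as → AllPairs Disjoint as
  Consistent⇒Disjoint zero apart = AllPairs.map (λ { {_ , stop} {_ , stop} (start≢ , _) → ⊥-elim (start≢ refl) }) apart
  Consistent⇒Disjoint (suc k) (apart , copies) = AllPairs.map disjoint (AllPairs.zip (apart ,
    AllPairs-filter-key digit _≟_ λ d → AllPairs-map⁻ (Consistent⇒Disjoint k (proj₂ (copies d)))))
    where
    disjoint : ∀ {a b} → Apart a b × (digit a ≡ digit b → Disjoint (rest a) (rest b)) → Disjoint a b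
    disjoint {_ , hop i d j _ r} {_ , hop i′ d′ j′ _ r′} ((start≢ , _) , _) (inj₁ _) (refl , refl) = start≢ refl
    disjoint {_ , hop i d j _ r} {_ , hop i′ d′ j′ _ r′} (_ , below) (inj₂ (_ , w)) ((refl , on) , (d≡d′ , on′)) =
      below d≡d′ w (on , on′)

  module _ {k : ℕ} where

    target≢-below : ∀ d y (as : List (Routed (suc k))) → All (λ b → ¬ target b ≡ combine d y) as →
                 All (λ b → ¬ target b ≡ y) (map rest (inCopy d as))
    target≢-below d y as target≢ = All-map⁺ (All.zipWith
      (λ { {b} (digit≡ , target≢b) target≡′ → target≢b (trans (target≡combine b) (cong₂ combine digit≡ target≡′)) })
      (all-filter (λ b → digit b ≟ d) as , filter⁺ (λ b → digit b ≟ d) target≢))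

    -- The n^k outputs of a copy bound the number of its routes, hence the edges Requester has placed.
    room-below : ∀ (bs : List (Routed (suc k))) y → AllPairs Apart (map rest bs) →
                 All (λ b → ¬ target b ≡ y) (map rest bs) → suc (#edges (usedEdges bs)) ≤ n ^ k
    room-below bs y apart target≢ = begin
      suc (#edges (usedEdges bs))     ≤⟨ s≤s (#usedEdges≤length bs) ⟩
      suc (length bs)                 ≡⟨ cong suc (trans (length-map target (map rest bs)) (length-map rest bs)) ⟨
      length (y ∷ map target (map rest bs)) ≤⟨ distinct⇒length≤ (y ∷ map target (map rest bs))
                                              (All-map⁺ (All.map ≢-sym target≢) ∷ AllPairs-map⁺ (AllPairs.map proj₂ apart)) ⟩
      n ^ k                           ∎
      where open ≤-Reasoning

    start≢-top : ∀ {i} d (as : List (Routed (suc k))) → All (λ b → ¬ start b ≡ inj₁ i) as →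
                 ∀ j → j ∉ usedEdges (inCopy d as) i
    start≢-top d as start≢ = usedEdges-free (inCopy d as)
      (filter⁺ (λ b → digit b ≟ d) (All.map (λ { {b} start≢b top≡ → start≢b (trans (start≡top b) (cong inj₁ top≡)) }) start≢))

  start≢-below : ∀ k (bs : List (Routed (suc k))) {j y} → (∀ x → j ∉ usedEdges bs x) →
                 All (λ b → ¬ target b ≡ y) (map rest bs) → All (λ b → ¬ start b ≡ entry k j) (map rest bs)
  start≢-below zero bs {y = zero} _ target≢ = All.map (λ { {_ , stop} target≢b _ → target≢b refl }) target≢
  start≢-below (suc c) bs {j} j-unused _ = All-map⁺ (All.map
    (λ { {b} fr∈ start≡ → j-unused (top b) (subst (λ j′ → j′ ∈ usedEdges bs (top b))
                                                   (entry-injective c (trans (sym (start-rest b)) start≡)) fr∈) })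
    (firstRight∈usedEdges bs))

  addRoute : ∀ k {as} → Consistent k as → ∀ {a} → IsTop k a → (y : Fin (n ^ k)) →
           All (λ b → ¬ start b ≡ a) as → All (λ b → ¬ target b ≡ y) as →
           ∃[ r ] (output {k} {a} r ≡ y × Consistent k ((a , r) ∷ as))
  addRoute zero apart {tt} _ zero start≢ target≢ =
    stop , refl , All.zipWith (λ (s≢ , o≢) → ≢-sym s≢ , ≢-sym o≢) (start≢ , target≢) ∷ apart
  addRoute (suc k) {as} (apart , copies) {inj₁ i} _ y start≢ target≢ = hop i d j j∈G r , output≡y , consistent
    where
    d : Fin n
    d = proj₁ (remQuot {n} (n ^ k) y)
    y′ : Fin (n ^ k)
    y′ = proj₂ (remQuot {n} (n ^ k) y)
    y≡ : combine d y′ ≡ y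
    y≡ = combine-remQuot {n} (n ^ k) y
    copy : List (Routed (suc k))
    copy = inCopy d as
    M : EdgeSet (left k) (right k)
    M = proj₁ (proj₁ (copies d))
    safe : Layer.Safe (layer k) M
    safe = proj₁ (proj₂ (proj₁ (copies d)))
    used⊆M : usedEdges copy ⊆ₑ M
    used⊆M = proj₂ (proj₂ (proj₁ (copies d)))
    below : Consistent k (map rest copy)
    below = proj₂ (copies d)
    target≢′ : All (λ b → ¬ target b ≡ y′) (map rest copy)
    target≢′ = target≢-below d y′ as (subst (λ z → All (λ b → ¬ target b ≡ z) as) (sym y≡) target≢)
    answer : ∃[ j ] (j ∈ graph k i × (∀ x → j ∉ usedEdges copy x) × Layer.Safe (layer k) (addEdge (usedEdges copy) i j))
    answer = Layer.respond (layer k) M safe (usedEdges copy) used⊆M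
               (room-below copy y′ (Consistent⇒Apart k below) target≢′) i (start≢-top d as start≢)
    j : Fin (right k)
    j = proj₁ answer
    j∈G : j ∈ graph k i
    j∈G = proj₁ (proj₂ answer)
    extended : ∃[ r ] (output r ≡ y′ × Consistent k ((entry k j , r) ∷ map rest copy))
    extended = addRoute k below (IsTop-entry k j) y′ (start≢-below k copy (proj₁ (proj₂ (proj₂ answer))) target≢′) target≢′
    r : Route k (entry k j)
    r = proj₁ extended
    output≡y : combine d (output r) ≡ y
    output≡y = trans (cong (combine d) (proj₁ (proj₂ extended))) y≡
    new : Routed (suc k)
    new = inj₁ i , hop i d j j∈G r
    copies′ : ∀ d′ → BelowSafe k (usedEdges (inCopy d′ (new ∷ as))) × Consistent k (map rest (inCopy d′ (new ∷ as)))
    copies′ d′ with d ≟ d′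
    ... | yes refl = (addEdge (usedEdges copy) i j , proj₂ (proj₂ (proj₂ answer)) , λ _ j∈ → j∈) , proj₂ (proj₂ extended)
    ... | no _ = copies d′
    consistent : Consistent (suc k) (new ∷ as)
    consistent = All.zipWith (λ (s≢ , o≢) → ≢-sym s≢ , λ target≡ → o≢ (trans (sym target≡) output≡y)) (start≢ , target≢)
                 ∷ apart , copies′

module Connector {n : ℕ} (T : Layered.Tower n) (t′ : ℕ)
                 (inputs≤ : n ^ suc t′ ≤ Layered.Layer.left (Layered.Tower.layer T t′)) where

  open import Defs
  open Counting using (sum-map-allFin; subset; ∈-subset⁺; ∈-subset⁻)
  open Layered
  open Construction T
  open Routes T
  open Strategy T
  open import Data.Nat.Properties using (m≢1+n+m; +-identityʳ; ≤-reflexive)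
  open import Data.Fin using (Fin; inject≤; fromℕ<)
  open import Data.Fin.Properties using (inject≤-injective)
  open import Data.Fin.Subset using (_∈_; _∉_; _⊆_; ∣_∣)
  open import Data.List using (List; []; _∷_; map)
  open import Data.List.Relation.Unary.All using (All; []; _∷_)
  open import Data.List.Relation.Unary.Any using (here)
  open import Data.List.Relation.Unary.AllPairs using (AllPairs; []; _∷_)
  open import Data.List.Relation.Binary.Sublist.Propositional using ([]; _∷_; _∷ʳ_) renaming (_⊆_ to _⊑_)
  open import Data.List.Relation.Binary.Sublist.Propositional.Properties using () renaming (map⁺ to map-⊑)
  open import Data.Product using (Σ; ∃-syntax; _×_; _,_; proj₁; proj₂)
  open import Data.Sum using (inj₁; inj₂)
  open import Data.Unit using (tt)
  import Data.Sum.Properties as Sum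
  open import Function using (_∘_)
  open import Relation.Nullary using (¬_)
  open import Relation.Binary.PropositionalEquality

  t : ℕ
  t = suc t′

  input : Fin (n ^ t) → Node t
  input x = inj₁ (inject≤ x inputs≤)

  input-injective : ∀ {x x′} → input x ≡ input x′ → x ≡ x′
  input-injective eq = inject≤-injective _ _ _ _ (Sum.inj₁-injective eq)

  network : Network (n ^ t)
  network = record
    { V        = size t
    ; E        = E t
    ; acyclic  = λ v m p → m≢1+n+m _ (Path⇒height t p)
    ; inp      = enc t ∘ input
    ; out      = enc t ∘ outNode t
    ; inp-inj  = input-injective ∘ enc-injective t
    ; out-inj  = outNode-injective t ∘ enc-injective t
    ; disjoint = λ _ _ eq → inj₁≢inj₂ (enc-injective t eq)
    }
    where
    inj₁≢inj₂ : ∀ {i b} → ¬ inj₁ i ≡ inj₂ b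
    inj₁≢inj₂ ()

  open Network network using (inp; out)

  TopRoute : Set
  TopRoute = Σ (Fin (n ^ t)) (Route t ∘ input)

  forget : TopRoute → Routed t
  forget (x , r) = input x , r

  toTree : TopRoute → TreeData network
  toTree (x , r) = tree x λ u → subset λ v → routeEdge? r (dec t u) (dec t v)

  module _ (a : TopRoute) where

    private
      x : Fin (n ^ t)
      x = proj₁ a
      r : Route t (input x)
      r = proj₂ a

    ∈tedges⁻ : ∀ {u v} → v ∈ tedges (toTree a) u → RouteEdge r (dec t u) (dec t v)
    ∈tedges⁻ {u} = ∈-subset⁻ λ v → routeEdge? r (dec t u) (dec t v)

    ∈tedges⁺ : ∀ {b c} → RouteEdge r b c → enc t c ∈ tedges (toTree a) (enc t b)
    ∈tedges⁺ {b} {c} b→c = ∈-subset⁺ (λ v → routeEdge? r (dec t (enc t b)) (dec t v))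
      (subst₂ (RouteEdge r) (sym (dec-enc t b)) (sym (dec-enc t c)) b→c)

    OnRoute⇒OnTree : ∀ v → OnRoute r (dec t v) → OnTree network (toTree a) v
    OnRoute⇒OnTree v on with OnRoute⇒start⊎RouteEdge r on
    ... | inj₁ v≡x = inj₁ (trans (sym (enc-dec t v)) (cong (enc t) v≡x))
    ... | inj₂ (b , b→v) = inj₂ (enc t b , subst (_∈ tedges (toTree a) (enc t b)) (enc-dec t v) (∈tedges⁺ b→v))

    OnTree⇒OnRoute : ∀ v → OnTree network (toTree a) v → OnRoute r (dec t v)
    OnTree⇒OnRoute v (inj₁ refl) = subst (OnRoute r) (sym (dec-enc t (input x))) (OnRoute-start r)
    OnTree⇒OnRoute v (inj₂ (u , v∈)) = RouteEdge⇒OnRouteʳ r (∈tedges⁻ v∈)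

    validTree : ValidTree network (toTree a)
    validTree = edges⊆E , tails-on-tree , root-unentered , unique-parent , leaves-are-outputs
      where
      edges⊆E : ∀ u → tedges (toTree a) u ⊆ E t u
      edges⊆E u {v} v∈ = subst (_∈ E t u) (enc-dec t v)
        (subst (λ u′ → enc t (dec t v) ∈ E t u′) (enc-dec t u) (Edge⇒∈E t (RouteEdge⇒Edge r (∈tedges⁻ v∈))))
      tails-on-tree : ∀ u v → v ∈ tedges (toTree a) u → OnTree network (toTree a) u
      tails-on-tree u v v∈ = OnRoute⇒OnTree u (RouteEdge⇒OnRouteˡ r (∈tedges⁻ v∈))
      root-unentered : ∀ u → inp x ∉ tedges (toTree a) u
      root-unentered u x∈ = ¬RouteEdge-start r (dec t u) (subst (RouteEdge r (dec t u)) (dec-enc t (input x)) (∈tedges⁻ x∈))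
      unique-parent : ∀ u u′ v → v ∈ tedges (toTree a) u → v ∈ tedges (toTree a) u′ → u ≡ u′
      unique-parent u u′ v v∈ v∈′ = dec-injective t (RouteEdge-injectiveˡ r (∈tedges⁻ v∈) (∈tedges⁻ v∈′))
      leaves-are-outputs : ∀ v → IsLeaf network (toTree a) v → IsOutput network v
      leaves-are-outputs v (on , no-child) = output r , trans (sym (enc-dec t v)) (cong (enc t)
        (terminal⇒output r (OnTree⇒OnRoute v on) λ c v→c →
          no-child (enc t c) (subst (λ c′ → enc t c ∈ tedges (toTree a) c′) (enc-dec t v) (∈tedges⁺ v→c))))

    output-IsLeaf : IsLeaf network (toTree a) (out (output r))
    output-IsLeaf = OnRoute⇒OnTree _ (subst (OnRoute r) (sym (dec-enc t _)) (OnRoute-output r))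
                  , λ w w∈ → ¬RouteEdge-output r (dec t w) (subst (λ b → RouteEdge r b (dec t w)) (dec-enc t _) (∈tedges⁻ w∈))

  validState : ∀ as → Consistent t (map forget as) → ValidState network (map toTree as)
  validState as consistent = all-valid as , pairwise-disjoint as (Consistent⇒Disjoint t consistent)
    where
    all-valid : ∀ as → All (ValidTree network) (map toTree as)
    all-valid [] = []
    all-valid (a ∷ as) = validTree a ∷ all-valid as
    disjoint-from : ∀ a as → All (Disjoint (forget a)) (map forget as) → All (NodeDisjoint network (toTree a)) (map toTree as)
    disjoint-from a [] [] = []
    disjoint-from a (b ∷ as) (a∩b≡∅ ∷ rest) =
      (λ v (on-a , on-b) → a∩b≡∅ (dec t v) (OnTree⇒OnRoute a v on-a , OnTree⇒OnRoute b v on-b)) ∷ disjoint-from a as rest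
    pairwise-disjoint : ∀ as → AllPairs Disjoint (map forget as) → AllPairs (NodeDisjoint network) (map toTree as)
    pairwise-disjoint [] [] = []
    pairwise-disjoint (a ∷ as) (a-disj ∷ disj) = disjoint-from a as a-disj ∷ pairwise-disjoint as disj

  ⊑-map-toTree : ∀ {ts} as → ts ⊑ map toTree as → ∃[ bs ] (bs ⊑ as × ts ≡ map toTree bs)
  ⊑-map-toTree [] [] = [] , [] , refl
  ⊑-map-toTree (a ∷ as) (_ ∷ʳ ts⊑) = let (bs , bs⊑ , ts≡) = ⊑-map-toTree as ts⊑ in bs , a ∷ʳ bs⊑ , ts≡
  ⊑-map-toTree (a ∷ as) (refl ∷ ts⊑) =
    let (bs , bs⊑ , ts≡) = ⊑-map-toTree as ts⊑ in a ∷ bs , refl ∷ bs⊑ , cong (toTree a ∷_) ts≡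

  input-free : ∀ x as → NotOnTrees network (map toTree as) (inp x) → All (λ b → ¬ start b ≡ input x) (map forget as)
  input-free x [] [] = []
  input-free x (a ∷ as) (x∉a ∷ x∉as) =
    (λ x′≡x → x∉a (subst (λ z → OnTree network (toTree a) (inp z)) (input-injective x′≡x) (inj₁ refl))) ∷ input-free x as x∉as

  output-free : ∀ y as → NotOnTrees network (map toTree as) (out y) → All (λ b → ¬ target b ≡ y) (map forget as)
  output-free y [] [] = []
  output-free y (a ∷ as) (y∉a ∷ y∉as) =
    (λ y′≡y → y∉a (subst (λ z → OnTree network (toTree a) (out z)) y′≡y (proj₁ (output-IsLeaf a)))) ∷ output-free y as y∉as

  isConnector : IsConnector network
  isConnector = Realised , ([] , refl , Consistent-[] t) , move
    where
    Realised : List (TreeData network) → Set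
    Realised ts = ∃[ as ] (ts ≡ map toTree as × Consistent t (map forget as))
    Kept : List (TreeData network) → Set
    Kept ts₁ = ∃[ ts₂ ] (ConnectorMove network ts₁ ts₂ × ValidState network ts₂ × Realised ts₂)
    Served : List (TreeData network) → Fin (n ^ t) → Fin (n ^ t) → Set
    Served ts₁ x y =
      ∃[ ts₂ ] (ConnectorMove network ts₁ ts₂ × ValidState network ts₂ × Satisfies network ts₂ x y × Realised ts₂)
    move : ∀ ts → Realised ts → ∀ ts₁ → ts₁ ⊑ ts →
           Kept ts₁ × (∀ x y → NotOnTrees network ts₁ (inp x) → NotOnTrees network ts₁ (out y) → Served ts₁ x y)
    move ts (as , refl , consistent) ts₁ ts₁⊑ with ⊑-map-toTree as ts₁⊑
    ... | bs , bs⊑as , refl = (map toTree bs , keep , validState bs consistent₁ , bs , refl , consistent₁) , request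
      where
      consistent₁ : Consistent t (map forget bs)
      consistent₁ = Consistent-⊑ t (map-⊑ forget bs⊑as) consistent
      request : ∀ x y → NotOnTrees network (map toTree bs) (inp x) → NotOnTrees network (map toTree bs) (out y) →
                Served (map toTree bs) x y
      request x y x-free y-free with addRoute t consistent₁ tt y (input-free x bs x-free) (output-free y bs y-free)
      ... | r , refl , consistent₂ = toTree (x , r) ∷ map toTree bs , create (toTree (x , r)) ,
            validState ((x , r) ∷ bs) consistent₂ , here (refl , output-IsLeaf (x , r)) , (x , r) ∷ bs , refl , consistent₂

  hasDepth : HasDepth network t
  hasDepth = paths≤t , path-of-length-t
    where
    paths≤t : ∀ i j k → Path (E t) (inp i) (out j) k → k ≤ t
    paths≤t i j k p with Path⇒height t p
    ... | heights rewrite dec-enc t (input i) | dec-enc t (outNode t j) | height-outNode t j =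
      ≤-reflexive (trans (sym (+-identityʳ k)) (sym heights))
    path-of-length-t : 1 ≤ n ^ t → ∃[ i ] ∃[ j ] Path (E t) (inp i) (out j) t
    path-of-length-t 1≤N with addRoute t (Consistent-[] t) {input (fromℕ< 1≤N)} tt (fromℕ< 1≤N) [] []
    ... | r , _ = fromℕ< 1≤N , output r , NodePath⇒Path t (Route⇒NodePath r)

  edgeCount≡edges : edgeCount network ≡ edges t
  edgeCount≡edges = trans (sum-map-allFin (size t) (λ u → ∣ E t u ∣)) (∑∣E∣≡edges t)

open import Defs
open import Data.Product using (Σ; ∃-syntax; _×_)
open import Data.Rational using (ℚ; 1ℚ; _*_) renaming (_≤_ to _≤ℚ_)
open import Relation.Binary.PropositionalEquality using (_≡_)

module NatCast where

  open import Data.Nat as ℕ using (z≤n)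
  open import Data.Nat.Divisibility using (∣1⇒≡1)
  open import Data.Integer as ℤ using (+_)
  import Data.Integer.Properties as ℤ
  open import Data.Rational using (mkℚ; _+_; _/_; NonNegative)
  open import Data.Rational.Properties
  open import Data.Rational.Base using (*≤*; nonNegative)
  open import Data.Rational.Solver using (module +-*-Solver)
  open import Data.Fin using (Fin; zero; suc)
  open import Data.Product using (_,_; proj₂)
  open import Relation.Binary.PropositionalEquality
  open Counting using (∑)

  ℕtoℚ≡mkℚ : ∀ m → ℕtoℚ m ≡ mkℚ (+ m) 0 (λ p → ∣1⇒≡1 (proj₂ p))
  ℕtoℚ≡mkℚ m = normalize-coprime {m} {0} (λ p → ∣1⇒≡1 (proj₂ p))

  ℕtoℚ-+ : ∀ a b → ℕtoℚ (a ℕ.+ b) ≡ ℕtoℚ a + ℕtoℚ b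
  ℕtoℚ-+ a b = trans (cong (_/ 1) (sym (cong₂ ℤ._+_ (ℤ.*-identityʳ (+ a)) (ℤ.*-identityʳ (+ b)))))
                     (sym (cong₂ _+_ (ℕtoℚ≡mkℚ a) (ℕtoℚ≡mkℚ b)))

  ℕtoℚ-* : ∀ a b → ℕtoℚ (a ℕ.* b) ≡ ℕtoℚ a * ℕtoℚ b
  ℕtoℚ-* a b = trans (cong (_/ 1) (ℤ.pos-* a b)) (sym (cong₂ _*_ (ℕtoℚ≡mkℚ a) (ℕtoℚ≡mkℚ b)))

  ℕtoℚ-mono : ∀ {a b} → a ℕ.≤ b → ℕtoℚ a ≤ℚ ℕtoℚ b
  ℕtoℚ-mono {a} {b} a≤b = subst₂ _≤ℚ_ (sym (ℕtoℚ≡mkℚ a)) (sym (ℕtoℚ≡mkℚ b))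
    (*≤* (subst₂ ℤ._≤_ (sym (ℤ.*-identityʳ (+ a))) (sym (ℤ.*-identityʳ (+ b))) (ℤ.+≤+ a≤b)))

  ℕtoℚ-cancel-≤ : ∀ {a b} → ℕtoℚ a ≤ℚ ℕtoℚ b → a ℕ.≤ b
  ℕtoℚ-cancel-≤ {a} {b} a≤b with subst₂ _≤ℚ_ (ℕtoℚ≡mkℚ a) (ℕtoℚ≡mkℚ b) a≤b
  ... | *≤* a≤b′ = ℤ.drop‿+≤+ (subst₂ ℤ._≤_ (ℤ.*-identityʳ (+ a)) (ℤ.*-identityʳ (+ b)) a≤b′)

  ℕtoℚ-nonNegative : ∀ m → NonNegative (ℕtoℚ m)
  ℕtoℚ-nonNegative m = nonNegative (ℕtoℚ-mono {0} {m} z≤n)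

  ∑-ℕtoℚ≤ : ∀ {m} (f : Fin m → ℕ.ℕ) {D} → (∀ i → ℕtoℚ (f i) ≤ℚ D) → ℕtoℚ (∑ f) ≤ℚ ℕtoℚ m * D
  ∑-ℕtoℚ≤ {ℕ.zero} f {D} _ = ≤-reflexive (sym (*-zeroˡ D))
  ∑-ℕtoℚ≤ {ℕ.suc m} f {D} f≤D = begin
    ℕtoℚ (f zero ℕ.+ ∑ (λ i → f (suc i)))            ≡⟨ ℕtoℚ-+ (f zero) _ ⟩
    ℕtoℚ (f zero) + ℕtoℚ (∑ (λ i → f (suc i)))       ≤⟨ +-mono-≤ (f≤D zero) (∑-ℕtoℚ≤ (λ i → f (suc i)) (λ i → f≤D (suc i))) ⟩
    D + ℕtoℚ m * D                                   ≡⟨ solve 2 (λ d m → d :+ m :* d := (con 1ℚ :+ m) :* d) refl D (ℕtoℚ m) ⟩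
    (1ℚ + ℕtoℚ m) * D                                ≡⟨ cong (_* D) (ℕtoℚ-+ 1 m) ⟨
    ℕtoℚ (ℕ.suc m) * D                               ∎
    where
    open ≤-Reasoning
    open +-*-Solver

Hypothesis : ℕ → ℕ → ℚ → ℚ → Set₁
Hypothesis t n C D = ∀ c → 1 ≤ c → c < t →
  ∃[ L ] ∃[ R ] Σ (BipGraph L R) λ G →
    ℕtoℚ L ≡ C * ℕtoℚ (n ^ suc c) ×
    ℕtoℚ R ≤ℚ C * ℕtoℚ (n ^ c) ×
    (∀ x → ℕtoℚ (leftDegree G x) ≤ℚ D) ×
    DynMatching G (n ^ c)

module Assembly (t′ n : ℕ) (C D : ℚ) (1≤C : 1ℚ ≤ℚ C) (1≤D : 1ℚ ≤ℚ D) (hyp : Hypothesis (suc t′) n C D) where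

  open Counting using (∑)
  open Matching using (DynMatching⇒Respond; star-respond; empty-respond)
  open Layered
  open NatCast
  open import Data.Nat as ℕ using (zero; z≤n; s≤s; _<?_)
  import Data.Nat.Properties as ℕ
  open import Data.Fin using (zero)
  open import Data.Fin.Subset using (⁅_⁆; ∣_∣)
  open import Data.Product using (_,_; proj₁; proj₂)
  open import Data.Rational using (0ℚ; _+_; NonNegative)
  open import Data.Rational.Properties
    using (≤-trans; ≤-reflexive; +-mono-≤; *-monoʳ-≤-nonNeg; *-monoˡ-≤-nonNeg; *-identityˡ; module ≤-Reasoning)
  open import Data.Rational.Base using (nonNegative)
  open import Data.Rational.Solver using (module +-*-Solver)
  open import Data.Unit using (⊤; tt)
  open import Data.Empty using (⊥-elim)
  open import Relation.Nullary using (Dec; yes; no)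
  open import Relation.Binary.PropositionalEquality using (refl; sym; trans; cong₂; subst)

  t : ℕ
  t = suc t′

  record Given (c : ℕ) : Set₁ where
    field
      L R       : ℕ
      G         : BipGraph L R
      L≡        : ℕtoℚ L ≡ C * ℕtoℚ (n ^ suc c)
      R≤        : ℕtoℚ R ≤ℚ C * ℕtoℚ (n ^ c)
      degree≤D  : ∀ x → ℕtoℚ (leftDegree G x) ≤ℚ D
      matching  : DynMatching G (n ^ c)

    layer : Layer (n ^ c)
    layer = record
      { left = L ; right = R ; graph = G
      ; Safe = proj₁ matching ; safe-empty = proj₁ (proj₂ matching) ; respond = DynMatching⇒Respond matching }

  given : ∀ c → 1 ≤ c → c < t → Given c
  given c 1≤c c<t = let (L , R , G , L≡ , R≤ , degree≤D , matching) = hyp c 1≤c c<t in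
    record { L = L ; R = R ; G = G ; L≡ = L≡ ; R≤ = R≤ ; degree≤D = degree≤D ; matching = matching }

  star : ℕ → Layer 1
  star L = record { left = L ; right = 1 ; graph = λ _ → ⁅ zero ⁆ ; Safe = λ _ → ⊤ ; safe-empty = tt ; respond = star-respond }

  emptyLayer : ∀ {K} → Layer K
  emptyLayer = record { left = 0 ; right = 0 ; graph = λ () ; Safe = λ _ → ⊤ ; safe-empty = tt ; respond = empty-respond _ _ _ }

  upperLayer : ∀ c → Dec (suc c < t) → Layer (n ^ suc c)
  upperLayer c (yes c<t) = Given.layer (given (suc c) (s≤s z≤n) c<t)
  upperLayer c (no _) = emptyLayer

  -- Layer 0 joins every right node of layer 1 (or, when t = 1, every input) to the single output
  -- of its copy.
  bottomLeft : Dec (1 < t) → ℕ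
  bottomLeft (yes 1<t) = Given.R (given 1 ℕ.≤-refl 1<t)
  bottomLeft (no _) = n

  layerAt : ∀ c → Layer (n ^ c)
  layerAt zero = star (bottomLeft (1 <? t))
  layerAt (suc c) = upperLayer c (suc c <? t)

  left right : ℕ → ℕ
  left c = Layer.left (layerAt c)
  right c = Layer.right (layerAt c)

  instance
    D-nonNegative : NonNegative D
    D-nonNegative = nonNegative (≤-trans (ℕtoℚ-mono {0} {1} z≤n) 1≤D)

  ≤C* : ∀ m → ℕtoℚ m ≤ℚ C * ℕtoℚ m
  ≤C* m = ≤-trans (≤-reflexive (sym (*-identityˡ (ℕtoℚ m)))) (*-monoʳ-≤-nonNeg (ℕtoℚ m) {{ℕtoℚ-nonNegative m}} 1≤C)

  right≤left : ∀ c → right (suc c) ℕ.≤ left c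
  right≤left zero = bottom (1 <? t)
    where
    bottom : (1<t? : Dec (1 < t)) → Layer.right (upperLayer 0 1<t?) ℕ.≤ bottomLeft 1<t?
    bottom (yes _) = ℕ.≤-refl
    bottom (no _) = z≤n
  right≤left (suc c) = upper (suc (suc c) <? t) (suc c <? t)
    where
    upper : ∀ c+2<t? c+1<t? → Layer.right (upperLayer (suc c) c+2<t?) ℕ.≤ Layer.left (upperLayer c c+1<t?)
    upper (yes c+2<t) (yes c+1<t) = ℕtoℚ-cancel-≤
      (≤-trans (Given.R≤ (given (suc (suc c)) _ c+2<t)) (≤-reflexive (sym (Given.L≡ (given (suc c) _ c+1<t)))))
    upper (yes c+2<t) (no c+1≮t) = ⊥-elim (c+1≮t (ℕ.<-trans (ℕ.n<1+n (suc c)) c+2<t))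
    upper (no _) _ = z≤n

  inputs≤ : n ^ t ℕ.≤ left t′
  inputs≤ = top t′ refl
    where
    top : ∀ c → c ≡ t′ → n ^ suc c ℕ.≤ left c
    top zero refl with 1 <? t
    ... | yes (s≤s ())
    ... | no _ = ℕ.≤-reflexive (ℕ.*-identityʳ n)
    top (suc c) refl with suc c <? t
    ... | yes c<t = ℕtoℚ-cancel-≤ (≤-trans (≤C* (n ^ suc (suc c))) (≤-reflexive (sym (Given.L≡ (given (suc c) _ c<t)))))
    ... | no c≮t = ⊥-elim (c≮t ℕ.≤-refl)

  left≤ : ∀ c → c < t → ℕtoℚ (left c) ≤ℚ C * ℕtoℚ (n ^ suc c)
  left≤ zero _ with 1 <? t
  ... | yes 1<t = Given.R≤ (given 1 ℕ.≤-refl 1<t)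
  ... | no _ = subst (λ m → ℕtoℚ n ≤ℚ C * ℕtoℚ m) (sym (ℕ.*-identityʳ n)) (≤C* n)
  left≤ (suc c) c<t with suc c <? t
  ... | yes c<t′ = ≤-reflexive (Given.L≡ (given (suc c) _ c<t′))
  ... | no c≮t = ⊥-elim (c≮t c<t)

  degree≤D : ∀ c x → ℕtoℚ ∣ Layer.graph (layerAt c) x ∣ ≤ℚ D
  degree≤D zero x = 1≤D
  degree≤D (suc c) x with suc c <? t
  ... | yes c<t = Given.degree≤D (given (suc c) _ c<t) x

  tower : Tower n
  tower = record { layer = layerAt ; right≤left = right≤left }

  open Construction tower using (edges; edges-suc)
  open Connector tower t′ inputs≤ public using (network; isConnector; hasDepth; edgeCount≡edges)

  edges≤ : ∀ k → k ℕ.≤ t → ℕtoℚ (edges k) ≤ℚ ℕtoℚ k * C * D * ℕtoℚ (n ^ suc k)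
  edges≤ zero _ = ≤-reflexive (solve 3 (λ c d p → con 0ℚ := con 0ℚ :* c :* d :* p) refl C D (ℕtoℚ (n ^ 1)))
    where open +-*-Solver
  edges≤ (suc k) k<t = begin
    ℕtoℚ (edges (suc k))
      ≤⟨ ℕtoℚ-mono (edges-suc k) ⟩
    ℕtoℚ (n ℕ.* S ℕ.+ n ℕ.* edges k)
      ≡⟨ trans (ℕtoℚ-+ (n ℕ.* S) (n ℕ.* edges k)) (cong₂ _+_ (ℕtoℚ-* n S) (ℕtoℚ-* n (edges k))) ⟩
    ν * ℕtoℚ S + ν * ℕtoℚ (edges k)
      ≤⟨ +-mono-≤ (*-monoˡ-≤-nonNeg ν {{ℕtoℚ-nonNegative n}}
                     (≤-trans (∑-ℕtoℚ≤ _ (degree≤D k)) (*-monoʳ-≤-nonNeg D (left≤ k k<t))))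
                  (*-monoˡ-≤-nonNeg ν {{ℕtoℚ-nonNegative n}} (edges≤ k (ℕ.<⇒≤ k<t))) ⟩
    ν * (C * P * D) + ν * (ℕtoℚ k * C * D * P)
      ≡⟨ solve 5 (λ ν k c d p → ν :* (c :* p :* d) :+ ν :* (k :* c :* d :* p) := (con 1ℚ :+ k) :* c :* d :* (ν :* p))
               refl ν (ℕtoℚ k) C D P ⟩
    (1ℚ + ℕtoℚ k) * C * D * (ν * P)
      ≡⟨ cong₂ (λ k′ p′ → k′ * C * D * p′) (ℕtoℚ-+ 1 k) (ℕtoℚ-* n (n ^ suc k)) ⟨
    ℕtoℚ (suc k) * C * D * ℕtoℚ (n ^ suc (suc k)) ∎
    where
    open ≤-Reasoning
    open +-*-Solver
    S : ℕ
    S = ∑ (λ i → ∣ Layer.graph (layerAt k) i ∣)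
    ν P : ℚ
    ν = ℕtoℚ n
    P = ℕtoℚ (n ^ suc k)

  edgeCount≤ : ℕtoℚ (edgeCount network) ≤ℚ ℕtoℚ t * C * D * ℕtoℚ (n ^ suc t)
  edgeCount≤ = subst (λ m → ℕtoℚ m ≤ℚ ℕtoℚ t * C * D * ℕtoℚ (n ^ suc t)) (sym edgeCount≡edges) (edges≤ t ℕ.≤-refl)

mainTheorem11 : (t : ℕ) → 1 ≤ t → (n : ℕ) → (C D : ℚ) → 1ℚ ≤ℚ C → 1ℚ ≤ℚ D →
    (∀ c → 1 ≤ c → c < t →
      ∃[ L ] ∃[ R ] Σ (BipGraph L R) λ G →
        ℕtoℚ L ≡ C * ℕtoℚ (n ^ suc c) ×
        ℕtoℚ R ≤ℚ C * ℕtoℚ (n ^ c) ×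
        (∀ x → ℕtoℚ (leftDegree G x) ≤ℚ D) ×
        DynMatching G (n ^ c)) →
    Σ (Network (n ^ t)) λ net →
      IsConnector net × HasDepth net t ×
      ℕtoℚ (edgeCount net) ≤ℚ ℕtoℚ t * C * D * ℕtoℚ (n ^ suc t)
mainTheorem11 (suc t′) _ n C D 1≤C 1≤D hyp = network , isConnector , hasDepth , edgeCount≤
  where
  open Assembly t′ n C D 1≤C 1≤D hyp
  open import Data.Product using (_,_)
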